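{- Let $k \ge 3$ be an odd integer and let $T$ be a tree with at least $3$ vertices. Then the hyperdeterminant of the order-$k$ Steiner distance hypermatrix of $T$ is equal to zero.
   Context: For a graph $G$ and a set $S \subseteq V(G)$, the Steiner distance $d_G(S)$ (also written $d_G(v_1,\ldots,v_k)$ when $S=\{v_1,\ldots,v_k\}$, repetitions allowed) is the minimum number of edges in a connected subgraph of $G$ containing all of $S$; in particular $d_G(\{v\})=0$. The order-$k$ Steiner distance hypermatrix of $G$ (with $V(G)=[n]$) is the order-$k$ cubical hypermatrix $\mathcal{S}_G$ of dimension $n$ whose $(v_1,\ldots,v_k)$ entry is $d_G(v_1,\ldots,v_k)$. The hyperdeterminant of an order-$k$, dimension-$n$ hypermatrix $M$ (in the sense of Gelfand–Kapranov–Zelevinsky) vanishes if and only if there is a nonzero $x\in\mathbb{C}^n$ with $\nabla f_M(x)=\vec 0$, where $f_M(x)=\sum_{i_1,\ldots,i_k} M_{i_1,\ldots,i_k}\prod_{j=1}^k x_{i_j}$. -}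

module Defs where

open import Level using (Level; _⊔_)
open import Data.Bool using (Bool; true; false; if_then_else_; _∧_)
open import Data.Nat using (ℕ; zero; suc; _≤_; _<ᵇ_) renaming (_+_ to _+ℕ_; _*_ to _*ℕ_)
open import Data.Fin using (Fin; zero; suc; toℕ; inject₁; fromℕ; _≟_)
open import Data.Product using (Σ; ∃; _×_; _,_)
open import Relation.Nullary using (¬_; yes; no)
open import Relation.Binary.PropositionalEquality using (_≡_)
open import Function.Definitions using (Injective)
open import Algebra.Bundles using (CommutativeRing)

record Graph (n : ℕ) : Set where
  field
    adj    : Fin n → Fin n → Bool
    sym    : ∀ i j → adj i j ≡ adj j i
    irrefl : ∀ i → adj i i ≡ false
open Graph public

data Reach {n : ℕ} (E : Fin n → Fin n → Bool) : Fin n → Fin n → Set where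
  here : ∀ {u} → Reach E u u
  step : ∀ {u w v} → E u w ≡ true → Reach E w v → Reach E u v

Connected : {n : ℕ} → Graph n → Set
Connected G = ∀ u v → Reach (adj G) u v

record Cycle {n : ℕ} (G : Graph n) : Set where
  field
    m      : ℕ
    vert   : Fin (suc (suc (suc m))) → Fin n
    inj    : Injective _≡_ _≡_ vert
    consec : ∀ (i : Fin (suc (suc m))) → adj G (vert (inject₁ i)) (vert (suc i)) ≡ true
    close  : adj G (vert (fromℕ (suc (suc m)))) (vert zero) ≡ true

Acyclic : {n : ℕ} → Graph n → Set
Acyclic G = ¬ Cycle G

IsTree : {n : ℕ} → Graph n → Set
IsTree G = Connected G × Acyclic G

sumℕ : (n : ℕ) → (Fin n → ℕ) → ℕ
sumℕ zero    f = 0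
sumℕ (suc n) f = f zero +ℕ sumℕ n (λ i → f (suc i))

record Subgraph {n : ℕ} (G : Graph n) : Set where
  field
    V     : Fin n → Bool
    E     : Fin n → Fin n → Bool
    E⊆G   : ∀ i j → E i j ≡ true → adj G i j ≡ true
    Esym  : ∀ i j → E i j ≡ E j i
    Eends : ∀ i j → E i j ≡ true → V i ≡ true
open Subgraph public

edgeCount : {n : ℕ} {G : Graph n} → Subgraph G → ℕ
edgeCount {n} H =
  sumℕ n (λ i → sumℕ n (λ j → if (toℕ i <ᵇ toℕ j) ∧ E H i j then 1 else 0))

SubConnected : {n : ℕ} {G : Graph n} → Subgraph G → Set
SubConnected H = ∀ u v → V H u ≡ true → V H v ≡ true → Reach (E H) u v

Contains : {n : ℕ} {G : Graph n} → Subgraph G → (Fin n → Set) → Set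
Contains H S = ∀ u → S u → V H u ≡ true

IsSteinerDist : {n : ℕ} → Graph n → (Fin n → Set) → ℕ → Set
IsSteinerDist G S d =
  (Σ (Subgraph G) λ H → SubConnected H × Contains H S × edgeCount H ≡ d)
  × (∀ (H : Subgraph G) → SubConnected H → Contains H S → d ≤ edgeCount H)

tupleSet : {k n : ℕ} → (Fin k → Fin n) → Fin n → Set
tupleSet {k} v u = ∃ λ (j : Fin k) → v j ≡ u

IsSteinerHypermatrix : {k n : ℕ} → Graph n → ((Fin k → Fin n) → ℕ) → Set
IsSteinerHypermatrix G D = ∀ v → IsSteinerDist G (tupleSet v) (D v)

Odd : ℕ → Set
Odd k = ∃ λ m → k ≡ suc (2 *ℕ m)

module _ {c ℓ : Level} (K : CommutativeRing c ℓ) where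
  open CommutativeRing K using (Carrier; _≈_; _+_; _*_; 0#; 1#)

  ℕ→K : ℕ → Carrier
  ℕ→K zero    = 0#
  ℕ→K (suc n) = 1# + ℕ→K n

  sumK : (n : ℕ) → (Fin n → Carrier) → Carrier
  sumK zero    f = 0#
  sumK (suc n) f = f zero + sumK n (λ i → f (suc i))

  prodK : (n : ℕ) → (Fin n → Carrier) → Carrier
  prodK zero    f = 1#
  prodK (suc n) f = f zero * prodK n (λ i → f (suc i))

  cons : {k n : ℕ} → Fin n → (Fin k → Fin n) → Fin (suc k) → Fin n
  cons a v zero    = a
  cons a v (suc j) = v j

  sumTuples : (k n : ℕ) → ((Fin k → Fin n) → Carrier) → Carrier
  sumTuples zero    n g = g (λ ())
  sumTuples (suc k) n g = sumK n (λ a → sumTuples k n (λ v → g (cons a v)))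

  powK : Carrier → ℕ → Carrier
  powK x zero    = 1#
  powK x (suc e) = x * powK x e

  record IsAlgClosedChar0Field : Set (c ⊔ ℓ) where
    field
      nontrivial : ¬ (1# ≈ 0#)
      inverse    : ∀ x → ¬ (x ≈ 0#) → ∃ λ y → x * y ≈ 1#
      char0      : ∀ m → ¬ (ℕ→K (suc m) ≈ 0#)
      algClosed  : ∀ (d : ℕ) (a : Fin (suc d) → Carrier) →
                   ∃ λ x → powK x (suc d) + sumK (suc d) (λ i → a i * powK x (toℕ i)) ≈ 0#

  -- partial derivative ∂f_M/∂x_m of
  -- f_M(x) = Σ_{i : Fin k → Fin n} M(i) ∏_j x_{i j}
  partialF : (k n : ℕ) → ((Fin k → Fin n) → ℕ) → (Fin n → Carrier) → Fin n → Carrier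
  partialF k n M x m =
    sumTuples k n (λ i → ℕ→K (M i) *
      sumK k (λ j → if isEq (i j) m
                      then prodK k (λ j′ → if isEq j j′ then 1# else x (i j′))
                      else 0#))
    where
      isEq : {p : ℕ} → Fin p → Fin p → Bool
      isEq a b with a ≟ b
      ... | yes _ = true
      ... | no  _ = false

  -- GKZ hyperdeterminant of M vanishes: some nonzero x has ∇f_M(x) = 0
  HyperdetVanishes : (k n : ℕ) → ((Fin k → Fin n) → ℕ) → Set (c ⊔ ℓ)
  HyperdetVanishes k n M =
    Σ (Fin n → Carrier) λ x → (∃ λ m → ¬ (x m ≈ 0#)) × (∀ m → partialF k n M x m ≈ 0#)

-- In a tree the Steiner distance of a tuple is the number of edges whose two sides it meets, so
-- f_S(x) is the sum over the edges ab of s^k - A^k - B^k, where A and B are the coordinate sums of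
-- x on the two sides of ab and s = A + B. Where s = 0 and k - 1 is even, every partial derivative
-- of f_S equals -k Σ_ab A^(k-1). On a path u v w take x = e_u + β e_v + γ e_w with γ^(k-1) = -1
-- and β = -1 - γ: the edge uv contributes 1, the edge vw contributes γ^(k-1) = -1, and every other
-- edge contributes 0.

module Submission where

open import Defs hiding (sym)
open import Level using (Level)
open import Data.Nat using (ℕ; zero; suc; _≤_; _<_; z≤n; s≤s; _<ᵇ_; NonZero) renaming (_+_ to _+ℕ_; _*_ to _*ℕ_)
import Data.Nat.Properties as ℕ
open import Data.Fin using (Fin; zero; suc; toℕ; inject₁; fromℕ; _≟_)
open import Data.Fin.Properties using (toℕ-injective)
open import Data.Bool using (Bool; true; false; if_then_else_; _∧_; _∨_; not)
open import Data.Bool.Properties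
  using (T-≡; ∧-conicalˡ; ∧-conicalʳ; ∨-conicalˡ; ∨-conicalʳ; ∧-comm; ∨-comm; ∧-assoc; ∧-zeroʳ; ∨-zeroʳ; ∨-identityʳ;
         not-injective)
open import Data.Product using (∃; ∃₂; _×_; _,_; proj₁; proj₂; swap; map₂)
open import Data.Sum using (_⊎_; inj₁; inj₂)
open import Data.Empty using (⊥; ⊥-elim)
open import Function using (_∘_; Equivalence)
open import Function.Definitions using (Injective)
open import Relation.Nullary using (¬_; yes; no; does)
open import Relation.Nullary.Decidable using (dec-true; dec-false)
open import Relation.Binary.Definitions using (tri<; tri≈; tri>)
open import Relation.Binary.PropositionalEquality using (_≡_; _≢_; refl; sym; trans; cong; cong₂; subst; subst₂)
open import Algebra.Bundles using (CommutativeRing)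
import Algebra.Properties.Ring as RingProperties
import Algebra.Properties.Semiring.Sum as SumProperties
import Algebra.Properties.CommutativeSemiring.Exp as ExpProperties
import Algebra.Properties.CommutativeSemigroup as CommutativeSemigroupProperties
import Algebra.Solver.Ring.NaturalCoefficients.Default as SemiringSolver
import Relation.Binary.Reasoning.Setoid as SetoidReasoning

private variable
  k n p : ℕ

infix 7 _≟ᵇ_ _<ᶠ_

_≟ᵇ_ : Fin p → Fin p → Bool
a ≟ᵇ b = does (a ≟ b)

≟ᵇ-refl : (a : Fin p) → (a ≟ᵇ a) ≡ true
≟ᵇ-refl a = dec-true (a ≟ a) refl

≟ᵇ⇒≡ : {a b : Fin p} → (a ≟ᵇ b) ≡ true → a ≡ b
≟ᵇ⇒≡ {a = a} {b} h with a ≟ b | h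
... | yes a≡b | _ = a≡b
... | no _    | ()

≢⇒≟ᵇ-false : {a b : Fin p} → a ≢ b → (a ≟ᵇ b) ≡ false
≢⇒≟ᵇ-false {a = a} {b} = dec-false (a ≟ b)

≟ᵇ-false⇒≢ : {a b : Fin p} → (a ≟ᵇ b) ≡ false → a ≢ b
≟ᵇ-false⇒≢ {a = a} h refl with trans (sym h) (≟ᵇ-refl a)
... | ()

_<ᶠ_ : Fin p → Fin p → Bool
i <ᶠ j = toℕ i <ᵇ toℕ j

<ᶠ-true : {i j : Fin p} → toℕ i < toℕ j → (i <ᶠ j) ≡ true
<ᶠ-true i<j = Equivalence.to T-≡ (ℕ.<⇒<ᵇ i<j)

<ᶠ-false : {i j : Fin p} → ¬ toℕ i < toℕ j → (i <ᶠ j) ≡ false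
<ᶠ-false {i = i} {j} i≮j with i <ᶠ j in eq
... | false = refl
... | true  = ⊥-elim (i≮j (ℕ.<ᵇ⇒< (toℕ i) (toℕ j) (Equivalence.from T-≡ eq)))

<ᶠ-orient : {a b : Fin p} → a ≢ b →
  ((a <ᶠ b) ≡ true × (b <ᶠ a) ≡ false) ⊎ ((a <ᶠ b) ≡ false × (b <ᶠ a) ≡ true)
<ᶠ-orient {a = a} {b} a≢b with ℕ.<-cmp (toℕ a) (toℕ b)
... | tri< a<b _ b≮a = inj₁ (<ᶠ-true a<b , <ᶠ-false b≮a)
... | tri≈ _ a≡b _   = ⊥-elim (a≢b (toℕ-injective a≡b))
... | tri> a≮b _ b<a = inj₂ (<ᶠ-false a≮b , <ᶠ-true b<a)

∨-true⇒ : ∀ {x y} → x ∨ y ≡ true → x ≡ true ⊎ y ≡ true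
∨-true⇒ {true}  _ = inj₁ refl
∨-true⇒ {false} h = inj₂ h

∧-false⇒ : ∀ {x y} → x ∧ y ≡ false → x ≡ false ⊎ y ≡ false
∧-false⇒ {false} _ = inj₁ refl
∧-false⇒ {true}  h = inj₂ h

anyᵇ : ∀ k → (Fin k → Bool) → Bool
anyᵇ zero    f = false
anyᵇ (suc k) f = f zero ∨ anyᵇ k (f ∘ suc)

allᵇ : ∀ k → (Fin k → Bool) → Bool
allᵇ zero    f = true
allᵇ (suc k) f = f zero ∧ allᵇ k (f ∘ suc)

anyᵇ⇒∃ : ∀ k {f : Fin k → Bool} → anyᵇ k f ≡ true → ∃ λ j → f j ≡ true
anyᵇ⇒∃ (suc k) {f} h with f zero in f₀
... | true  = zero , f₀
... | false with anyᵇ⇒∃ k h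
...   | j , fj = suc j , fj

∃⇒anyᵇ : ∀ k {f : Fin k → Bool} j → f j ≡ true → anyᵇ k f ≡ true
∃⇒anyᵇ (suc k) zero    fj rewrite fj = refl
∃⇒anyᵇ (suc k) {f} (suc j) fj rewrite ∃⇒anyᵇ k {f ∘ suc} j fj = ∨-zeroʳ (f zero)

anyᵇ-false⇒ : ∀ k {f : Fin k → Bool} → anyᵇ k f ≡ false → ∀ j → f j ≡ false
anyᵇ-false⇒ k {f} none j with f j in fj
... | false = refl
... | true  with trans (sym none) (∃⇒anyᵇ k j fj)
...   | ()

anyᵇ≡not-allᵇ-not : ∀ k (f : Fin k → Bool) → anyᵇ k f ≡ not (allᵇ k (not ∘ f))
anyᵇ≡not-allᵇ-not zero    f = refl
anyᵇ≡not-allᵇ-not (suc k) f with f zero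
... | true  = refl
... | false = anyᵇ≡not-allᵇ-not k (f ∘ suc)

anyᵇ-not≡not-allᵇ : ∀ k (f : Fin k → Bool) → anyᵇ k (not ∘ f) ≡ not (allᵇ k f)
anyᵇ-not≡not-allᵇ zero    f = refl
anyᵇ-not≡not-allᵇ (suc k) f with f zero
... | true  = anyᵇ-not≡not-allᵇ k (f ∘ suc)
... | false = refl

allᵇ-and-allᵇ-not : ∀ k (f : Fin (suc k) → Bool) → allᵇ (suc k) f ∧ allᵇ (suc k) (not ∘ f) ≡ false
allᵇ-and-allᵇ-not k f with f zero
... | true  = ∧-zeroʳ _
... | false = refl

straddles : ∀ k → (Fin k → Bool) → Bool
straddles k f = anyᵇ k f ∧ anyᵇ k (not ∘ f)

⟦_⟧ℕ : Bool → ℕ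
⟦ b ⟧ℕ = if b then 1 else 0

⟦⟧ℕ-mono : {a b : Bool} → (a ≡ true → b ≡ true) → ⟦ a ⟧ℕ ≤ ⟦ b ⟧ℕ
⟦⟧ℕ-mono {false} a⇒b = z≤n
⟦⟧ℕ-mono {true}  a⇒b rewrite a⇒b refl = s≤s z≤n

⟦⟧ℕ-< : {a b : Bool} → a ≡ false → b ≡ true → ⟦ a ⟧ℕ < ⟦ b ⟧ℕ
⟦⟧ℕ-< refl refl = s≤s z≤n

⟦⟧ℕ≤1 : ∀ b → ⟦ b ⟧ℕ ≤ 1
⟦⟧ℕ≤1 true  = s≤s z≤n
⟦⟧ℕ≤1 false = z≤n

sumℕ-cong : ∀ n {f g : Fin n → ℕ} → (∀ i → f i ≡ g i) → sumℕ n f ≡ sumℕ n g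
sumℕ-cong zero    f≗g = refl
sumℕ-cong (suc n) f≗g = cong₂ _+ℕ_ (f≗g zero) (sumℕ-cong n (f≗g ∘ suc))

sumℕ-mono : ∀ n {f g : Fin n → ℕ} → (∀ i → f i ≤ g i) → sumℕ n f ≤ sumℕ n g
sumℕ-mono zero    f≤g = z≤n
sumℕ-mono (suc n) f≤g = ℕ.+-mono-≤ (f≤g zero) (sumℕ-mono n (f≤g ∘ suc))

sumℕ-mono-< : ∀ n {f g : Fin n → ℕ} → (∀ i → f i ≤ g i) → ∀ i₀ → f i₀ < g i₀ → sumℕ n f < sumℕ n g
sumℕ-mono-< (suc n) f≤g zero     f<g = ℕ.+-mono-<-≤ f<g (sumℕ-mono n (f≤g ∘ suc))
sumℕ-mono-< (suc n) f≤g (suc i₀) f<g = ℕ.+-mono-≤-< (f≤g zero) (sumℕ-mono-< n (f≤g ∘ suc) i₀ f<g)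

size : ∀ n → (Fin n → Bool) → ℕ
size n X = sumℕ n (⟦_⟧ℕ ∘ X)

size≤n : ∀ n (X : Fin n → Bool) → size n X ≤ n
size≤n zero    X = z≤n
size≤n (suc n) X = ℕ.+-mono-≤ (⟦⟧ℕ≤1 (X zero)) (size≤n n (X ∘ suc))

SameEdge : Fin n → Fin n → Fin n → Fin n → Set
SameEdge a b y z = (y ≡ a × z ≡ b) ⊎ (y ≡ b × z ≡ a)

sameEdge : Fin n → Fin n → Fin n → Fin n → Bool
sameEdge a b y z = (y ≟ᵇ a ∧ z ≟ᵇ b) ∨ (y ≟ᵇ b ∧ z ≟ᵇ a)

sameEdge⇒SameEdge : (a b y z : Fin n) → sameEdge a b y z ≡ true → SameEdge a b y z
sameEdge⇒SameEdge a b y z h with y ≟ᵇ a ∧ z ≟ᵇ b in e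
... | true  = inj₁ (≟ᵇ⇒≡ (∧-conicalˡ _ _ e) , ≟ᵇ⇒≡ (∧-conicalʳ _ _ e))
... | false = inj₂ (≟ᵇ⇒≡ (∧-conicalˡ _ _ h) , ≟ᵇ⇒≡ (∧-conicalʳ _ _ h))

SameEdge⇒sameEdge : {a b y z : Fin n} → SameEdge a b y z → sameEdge a b y z ≡ true
SameEdge⇒sameEdge {a = a} {b} (inj₁ (refl , refl)) rewrite ≟ᵇ-refl a | ≟ᵇ-refl b = refl
SameEdge⇒sameEdge {a = a} {b} (inj₂ (refl , refl)) rewrite ≟ᵇ-refl a | ≟ᵇ-refl b = ∨-zeroʳ _

SameEdge-sym : {a b y z : Fin n} → SameEdge a b y z → SameEdge y z a b
SameEdge-sym (inj₁ (refl , refl)) = inj₁ (refl , refl)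
SameEdge-sym (inj₂ (refl , refl)) = inj₂ (refl , refl)

SameEdge-flip : {a b y z : Fin n} → SameEdge a b y z → SameEdge a b z y
SameEdge-flip (inj₁ (y≡a , z≡b)) = inj₂ (z≡b , y≡a)
SameEdge-flip (inj₂ (y≡b , z≡a)) = inj₁ (z≡a , y≡b)

sameEdge-false⇒¬SameEdge : (a b y z : Fin n) → sameEdge y z a b ≡ false → ¬ SameEdge a b y z
sameEdge-false⇒¬SameEdge a b y z off on with trans (sym off) (SameEdge⇒sameEdge (SameEdge-sym on))
... | ()

sameEdge-sym : (a b y z : Fin n) → sameEdge a b y z ≡ sameEdge a b z y
sameEdge-sym a b y z rewrite ∧-comm (y ≟ᵇ a) (z ≟ᵇ b) | ∧-comm (y ≟ᵇ b) (z ≟ᵇ a) =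
  ∨-comm (z ≟ᵇ b ∧ y ≟ᵇ a) _

record IsCut (G : Graph n) (σ : Fin n → Bool) (a b : Fin n) : Set where
  field
    inside   : σ a ≡ true
    outside  : σ b ≡ false
    crossing : ∀ {y z} → adj G y z ≡ true → σ y ≡ true → σ z ≡ false → y ≡ a × z ≡ b

IsCut-complement : {G : Graph n} {σ : Fin n → Bool} {a b : Fin n} →
  IsCut G σ a b → IsCut G (not ∘ σ) b a
IsCut-complement {G = G} {σ} cut = record
  { inside   = cong not outside
  ; outside  = cong not inside
  ; crossing = λ {y} {z} yz σy σz →
      swap (crossing (trans (Graph.sym G z y) yz) (not-injective σz) (not-injective σy))
  }
  where open IsCut cut

cut-sameSide : {G : Graph n} {σ : Fin n → Bool} {a b y z : Fin n} → IsCut G σ a b →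
  adj G y z ≡ true → ¬ SameEdge a b y z → σ y ≡ σ z
cut-sameSide {G = G} {σ} {y = y} {z} cut yz ¬ab with σ y in σy | σ z in σz
... | true  | true  = refl
... | false | false = refl
... | true  | false = ⊥-elim (¬ab (inj₁ (IsCut.crossing cut yz σy σz)))
... | false | true  with IsCut.crossing cut (trans (Graph.sym G z y) yz) σz σy
...   | z≡a , y≡b = ⊥-elim (¬ab (inj₂ (y≡b , z≡a)))

cut-separates : {G : Graph n} {σ : Fin n → Bool} {a b y z : Fin n} → IsCut G σ a b →
  SameEdge a b y z → σ y ≡ not (σ z)
cut-separates cut (inj₁ (refl , refl)) rewrite IsCut.inside cut | IsCut.outside cut = refl
cut-separates cut (inj₂ (refl , refl)) rewrite IsCut.inside cut | IsCut.outside cut = refl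

record SimplePath (E : Fin n → Fin n → Bool) (X : Fin n → Bool) (z a : Fin n) (len : ℕ) : Set where
  field
    vertex    : Fin (suc len) → Fin n
    start     : vertex zero ≡ z
    finish    : vertex (fromℕ len) ≡ a
    injective : Injective _≡_ _≡_ vertex
    steps     : ∀ i → E (vertex (inject₁ i)) (vertex (suc i)) ≡ true
    inside    : ∀ i → X (vertex i) ≡ true

module _ {E : Fin n → Fin n → Bool} where

  SimplePath-here : {X : Fin n → Bool} {a : Fin n} → X a ≡ true → SimplePath E X a a zero
  SimplePath-here {a = a} Xa = record
    { vertex = λ _ → a ; start = refl ; finish = refl ; injective = constant-injective
    ; steps = λ () ; inside = λ _ → Xa }
    where
      constant-injective : Injective _≡_ _≡_ (λ (_ : Fin 1) → a)
      constant-injective {zero} {zero} _ = refl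

  SimplePath-weaken : {X Y : Fin n → Bool} {z a : Fin n} {len : ℕ} → (∀ {y} → X y ≡ true → Y y ≡ true) →
    SimplePath E X z a len → SimplePath E Y z a len
  SimplePath-weaken X⊆Y P = record
    { vertex = vertex ; start = start ; finish = finish ; injective = injective
    ; steps = steps ; inside = X⊆Y ∘ inside }
    where open SimplePath P

  SimplePath-cons : {X Y : Fin n → Bool} {y z a : Fin n} {len : ℕ} → (∀ {x} → X x ≡ true → Y x ≡ true) →
    X z ≡ false → Y z ≡ true → E z y ≡ true → SimplePath E X y a len → SimplePath E Y z a (suc len)
  SimplePath-cons {X = X} {Y} {z = z} {len = len} X⊆Y Xz Yz zy P = record
    { vertex = vertex′ ; start = refl ; finish = finish ; injective = injective′
    ; steps = steps′ ; inside = inside′ }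
    where
      open SimplePath P
      vertex′ : Fin (suc (suc len)) → Fin n
      vertex′ zero    = z
      vertex′ (suc i) = vertex i
      fresh : ∀ i → z ≢ vertex i
      fresh i z≡vᵢ with trans (sym Xz) (subst (λ w → X w ≡ true) (sym z≡vᵢ) (inside i))
      ... | ()
      injective′ : Injective _≡_ _≡_ vertex′
      injective′ {zero}  {zero}  _ = refl
      injective′ {zero}  {suc j} eq = ⊥-elim (fresh j eq)
      injective′ {suc i} {zero}  eq = ⊥-elim (fresh i (sym eq))
      injective′ {suc i} {suc j} eq = cong suc (injective eq)
      steps′ : ∀ i → E (vertex′ (inject₁ i)) (vertex′ (suc i)) ≡ true
      steps′ zero    = subst (λ w → E z w ≡ true) (sym start) zy
      steps′ (suc i) = steps i
      inside′ : ∀ i → Y (vertex′ i) ≡ true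
      inside′ zero    = Yz
      inside′ (suc i) = X⊆Y (inside i)

SimplePath-cycle : {G : Graph n} {E : Fin n → Fin n → Bool} {X : Fin n → Bool} {z a : Fin n} {m : ℕ} →
  (∀ {y w} → E y w ≡ true → adj G y w ≡ true) → SimplePath E X z a (suc (suc m)) → adj G a z ≡ true → Cycle G
SimplePath-cycle {G = G} {m = m} E⊆G P az = record
  { m = m ; vert = vertex ; inj = injective ; consec = E⊆G ∘ steps ; close = closing }
  where
    open SimplePath P
    closing : adj G (vertex (fromℕ (suc (suc m)))) (vertex zero) ≡ true
    closing rewrite finish | start = az

adj-SameEdge : (G : Graph n) {a b y z : Fin n} → SameEdge y z a b → adj G y z ≡ true → adj G a b ≡ true
adj-SameEdge G (inj₁ (refl , refl)) yz = yz
adj-SameEdge G {y = y} {z} (inj₂ (refl , refl)) yz = trans (Graph.sym G z y) yz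

adj⇒≢ : (G : Graph n) {y z : Fin n} → adj G y z ≡ true → y ≢ z
adj⇒≢ G {y} yz refl with trans (sym yz) (irrefl G y)
... | ()

-- The side of an edge ab: the vertices reachable from a without using ab

module EdgeSide (G : Graph n) (a b : Fin n) where

  adj∖ab : Fin n → Fin n → Bool
  adj∖ab y z = adj G y z ∧ not (sameEdge a b y z)

  adj∖ab-sym : ∀ y z → adj∖ab y z ≡ adj∖ab z y
  adj∖ab-sym y z rewrite Graph.sym G y z | sameEdge-sym a b y z = refl

  ball : ℕ → Fin n → Bool
  ball zero    z = z ≟ᵇ a
  ball (suc t) z = ball t z ∨ anyᵇ n (λ y → ball t y ∧ adj∖ab y z)

  Closed : (Fin n → Bool) → Set
  Closed X = ∀ {y z} → X y ≡ true → adj∖ab y z ≡ true → X z ≡ true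

  ball-⊆-suc : ∀ t {z} → ball t z ≡ true → ball (suc t) z ≡ true
  ball-⊆-suc t h rewrite h = refl

  ball-centre : ∀ t → ball t a ≡ true
  ball-centre zero    = ≟ᵇ-refl a
  ball-centre (suc t) = ball-⊆-suc t (ball-centre t)

  ball-step : ∀ t {y z} → ball t y ≡ true → adj∖ab y z ≡ true → ball (suc t) z ≡ true
  ball-step t {y} {z} by yz with ball t z
  ... | true  = refl
  ... | false = ∃⇒anyᵇ n y (cong₂ _∧_ by yz)

  closed⇒ball-suc⊆ : ∀ t → Closed (ball t) → ∀ {z} → ball (suc t) z ≡ true → ball t z ≡ true
  closed⇒ball-suc⊆ t closed h with ∨-true⇒ h
  ... | inj₁ old = old
  ... | inj₂ via with anyᵇ⇒∃ n via
  ...   | y , hy = closed (∧-conicalˡ (ball t y) _ hy) (∧-conicalʳ (ball t y) _ hy)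

  ball-suc⊆⇒closed : ∀ t → (∀ {z} → ball (suc t) z ≡ true → ball t z ≡ true) → Closed (ball (suc t))
  ball-suc⊆⇒closed t shrinks by yz = ball-step t (shrinks by) yz

  ball-grows : ∀ t → (∃ λ z → ball (suc t) z ∧ not (ball t z) ≡ true) → size n (ball t) < size n (ball (suc t))
  ball-grows t (z₀ , new) = sumℕ-mono-< n (λ z → ⟦⟧ℕ-mono (ball-⊆-suc t)) z₀
    (⟦⟧ℕ-< (not-injective (∧-conicalʳ _ _ new)) (∧-conicalˡ _ _ new))

  ball-stalls : ∀ t → anyᵇ n (λ z → ball (suc t) z ∧ not (ball t z)) ≡ false →
    ∀ {z} → ball (suc t) z ≡ true → ball t z ≡ true
  ball-stalls t none {z} h = not-injective (subst (λ q → q ∧ not (ball t z) ≡ false) h (anyᵇ-false⇒ n none z))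

  ball-closed-or-large : ∀ t → Closed (ball t) ⊎ t ≤ size n (ball t)
  ball-closed-or-large zero = inj₂ z≤n
  ball-closed-or-large (suc t) with ball-closed-or-large t
  ... | inj₁ closed = inj₁ (ball-suc⊆⇒closed t (closed⇒ball-suc⊆ t closed))
  ... | inj₂ large with anyᵇ n (λ z → ball (suc t) z ∧ not (ball t z)) in fresh
  ...   | true  = inj₂ (ℕ.≤-trans (s≤s large) (ball-grows t (anyᵇ⇒∃ n fresh)))
  ...   | false = inj₁ (ball-suc⊆⇒closed t (ball-stalls t fresh))

  side : Fin n → Bool
  side = ball (suc n)

  side-closed : Closed side
  side-closed with ball-closed-or-large (suc n)
  ... | inj₁ closed = closed
  ... | inj₂ large  = ⊥-elim (ℕ.<-irrefl refl (ℕ.≤-trans large (size≤n n side)))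

  ball-path : ∀ t {z} → ball t z ≡ true → ∃ (SimplePath adj∖ab (ball t) z a)
  ball-path zero {z} h with ≟ᵇ⇒≡ {a = z} {b = a} h
  ... | refl = zero , SimplePath-here (≟ᵇ-refl a)
  ball-path (suc t) {z} h with ball t z in old
  ... | true  = map₂ (SimplePath-weaken (ball-⊆-suc t)) (ball-path t old)
  ... | false with anyᵇ⇒∃ n h
  ...   | y , hy with ∧-conicalˡ (ball t y) _ hy | ∧-conicalʳ (ball t y) _ hy
  ...     | by | yz with ball-path t by
  ...       | len , P =
    suc len , SimplePath-cons (ball-⊆-suc t) old (ball-step t by yz) (trans (adj∖ab-sym z y) yz) P

  module _ (ab : adj G a b ≡ true) (acyclic : Acyclic G) where

    -- a path from b back to a avoiding ab would close a cycle with ab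
    b∉side : side b ≡ false
    b∉side with side b in e
    ... | false = refl
    ... | true with ball-path (suc n) e
    ...   | zero , P = ⊥-elim (adj⇒≢ G ab (sym (trans (sym start) finish)))
      where open SimplePath P
    ...   | suc zero , P with trans (sym (subst₂ (λ y z → adj∖ab y z ≡ true) start finish (steps zero))) ba∉G∖ab
      where
        open SimplePath P
        ba∉G∖ab : adj∖ab b a ≡ false
        ba∉G∖ab rewrite SameEdge⇒sameEdge {a = a} {b} {b} {a} (inj₂ (refl , refl)) = ∧-zeroʳ _
    ...     | ()
    b∉side | true | suc (suc m) , P = ⊥-elim (acyclic (SimplePath-cycle (∧-conicalˡ _ _) P ab))

    side-cut : IsCut G side a b
    side-cut = record { inside = ball-centre (suc n) ; outside = b∉side ; crossing = crossing }
      where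
        crossing : ∀ {y z} → adj G y z ≡ true → side y ≡ true → side z ≡ false → y ≡ a × z ≡ b
        crossing {y} {z} yz sy sz with adj∖ab y z in e
        ... | true with trans (sym sz) (side-closed sy e)
        ...   | ()
        crossing {y} {z} yz sy sz | false with sameEdge⇒SameEdge a b y z (not-injective (subst (λ q → q ∧ _ ≡ false) yz e))
        ...   | inj₁ y≡a,z≡b = y≡a,z≡b
        ...   | inj₂ (refl , refl) with trans (sym sy) b∉side
        ...     | ()

side : Graph n → Fin n → Fin n → Fin n → Bool
side G a b = EdgeSide.side G a b

side-cut : {G : Graph n} → Acyclic G → {a b : Fin n} → adj G a b ≡ true → IsCut G (side G a b) a b
side-cut {G = G} acyclic {a} {b} ab = EdgeSide.side-cut G a b ab acyclic

-- Steiner distances in acyclic graphs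

isEdge : Graph n → Fin n → Fin n → Bool
isEdge G a b = a <ᶠ b ∧ adj G a b

cutCount : (Fin n → Fin n → Bool) → (Fin n → Fin n → Fin n → Bool) → (Fin k → Fin n) → ℕ
cutCount {n} {k} select part v = sumℕ n λ a → sumℕ n λ b → ⟦ select a b ∧ straddles k (part a b ∘ v) ⟧ℕ

module _ {G : Graph n} where

  cut-edge-on-walk : {σ : Fin n → Bool} {a b y z : Fin n} → IsCut G σ a b → (H : Subgraph G) →
    Reach (E H) y z → σ y ≡ true → σ z ≡ false → E H a b ≡ true
  cut-edge-on-walk cut H here σy σz with trans (sym σy) σz
  ... | ()
  cut-edge-on-walk {σ = σ} cut H (step {u} {w} uw walk) σu σz with σ w in σw
  ... | true  = cut-edge-on-walk cut H walk σw σz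
  ... | false with IsCut.crossing cut (E⊆G H u w uw) σu σw
  ...   | refl , refl = uw

  restrict : Subgraph G → (Fin n → Bool) → Subgraph G
  restrict H σ = record
    { V     = λ z → V H z ∧ σ z
    ; E     = λ y z → E H y z ∧ (σ y ∧ σ z)
    ; E⊆G   = λ y z h → E⊆G H y z (∧-conicalˡ _ _ h)
    ; Esym  = λ y z → cong₂ _∧_ (Esym H y z) (∧-comm (σ y) (σ z))
    ; Eends = λ y z h → cong₂ _∧_ (Eends H y z (∧-conicalˡ _ _ h)) (∧-conicalˡ (σ y) _ (∧-conicalʳ (E H y z) _ h))
    }

  edgeCount-<-at : (H′ H : Subgraph G) → (∀ {i j} → E H′ i j ≡ true → E H i j ≡ true) →
    ∀ {a b} → (a <ᶠ b) ≡ true → E H a b ≡ true → E H′ a b ≡ false → edgeCount H′ < edgeCount H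
  edgeCount-<-at H′ H H′⊆H {a} {b} a<b Hab H′ab =
    sumℕ-mono-< n (λ i → sumℕ-mono n (pointwise i)) a
      (sumℕ-mono-< n (pointwise a) b (⟦⟧ℕ-< (cong₂ _∧_ a<b H′ab) (cong₂ _∧_ a<b Hab)))
    where
      pointwise : ∀ i j → ⟦ i <ᶠ j ∧ E H′ i j ⟧ℕ ≤ ⟦ i <ᶠ j ∧ E H i j ⟧ℕ
      pointwise i j = ⟦⟧ℕ-mono (λ h → cong₂ _∧_ (∧-conicalˡ _ _ h) (H′⊆H (∧-conicalʳ (i <ᶠ j) _ h)))

  edgeCount-< : (H′ H : Subgraph G) → (∀ {i j} → E H′ i j ≡ true → E H i j ≡ true) →
    ∀ {a b} → E H a b ≡ true → E H′ a b ≡ false → edgeCount H′ < edgeCount H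
  edgeCount-< H′ H H′⊆H {a} {b} Hab H′ab with <ᶠ-orient (adj⇒≢ G (E⊆G H a b Hab))
  ... | inj₁ (a<b , _) = edgeCount-<-at H′ H H′⊆H a<b Hab H′ab
  ... | inj₂ (_ , b<a) = edgeCount-<-at H′ H H′⊆H b<a (trans (Esym H b a) Hab) (trans (Esym H′ b a) H′ab)

  module _ {σ : Fin n → Bool} {a b : Fin n} (cut : IsCut G σ a b) (H : Subgraph G) where

    restricted-edge : ∀ {y w} → E H y w ≡ true → σ y ≡ true → σ w ≡ true → E (restrict H σ) y w ≡ true
    restricted-edge Hyw σy σw rewrite Hyw | σy | σw = refl

    -- the only edge of H leaving σ is ab, so collapsing the far side onto a turns walks into walks
    collapse : Fin n → Fin n
    collapse z = if σ z then z else a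

    collapse-walk : ∀ {y z} → Reach (E H) y z → Reach (E (restrict H σ)) (collapse y) (collapse z)
    collapse-walk here = here
    collapse-walk (step {y} {w} yw walk) with σ y in σy | σ w in σw | collapse-walk walk
    ... | true  | true  | rest = step (restricted-edge yw σy σw) rest
    ... | false | false | rest = rest
    ... | true  | false | rest with IsCut.crossing cut (E⊆G H y w yw) σy σw
    ...   | refl , refl = rest
    collapse-walk (step {y} {w} yw walk) | false | true | rest
      with IsCut.crossing cut (E⊆G H w y (trans (Esym H w y) yw)) σw σy
    ...   | refl , refl = rest

    restrict-connected : SubConnected H → SubConnected (restrict H σ)
    restrict-connected connected u v hu hv =
      subst₂ (Reach _) (collapse-fixed (∧-conicalʳ (V H u) _ hu)) (collapse-fixed (∧-conicalʳ (V H v) _ hv))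
        (collapse-walk (connected u v (∧-conicalˡ _ _ hu) (∧-conicalˡ _ _ hv)))
      where
        collapse-fixed : ∀ {z} → σ z ≡ true → collapse z ≡ z
        collapse-fixed σz rewrite σz = refl

    restrict-smaller : E H a b ≡ true → edgeCount (restrict H σ) < edgeCount H
    restrict-smaller Hab = edgeCount-< (restrict H σ) H (∧-conicalˡ _ _) Hab ab-removed
      where
        ab-removed : E H a b ∧ (σ a ∧ σ b) ≡ false
        ab-removed rewrite IsCut.inside cut | IsCut.outside cut = ∧-zeroʳ _

  E⊆G-false : (H : Subgraph G) {a b : Fin n} → adj G a b ≡ false → E H a b ≡ false
  E⊆G-false H {a} {b} ab with E H a b in Hab
  ... | false = refl
  ... | true with trans (sym ab) (E⊆G H a b Hab)
  ...   | ()

  module MinimalSubgraph {k : ℕ} {v : Fin k → Fin n} (H : Subgraph G) (connected : SubConnected H)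
                 (contains : Contains H (tupleSet v))
                 (minimal : (H′ : Subgraph G) → SubConnected H′ → Contains H′ (tupleSet v) → edgeCount H ≤ edgeCount H′) where

    avoids-cut-edge : {σ : Fin n → Bool} {a b : Fin n} → IsCut G σ a b → (∀ j → σ (v j) ≡ true) → E H a b ≡ false
    avoids-cut-edge {σ} {a} {b} cut inside with E H a b in Hab
    ... | false = refl
    ... | true  = ⊥-elim (ℕ.<⇒≱ (restrict-smaller cut H Hab)
                    (minimal (restrict H σ) (restrict-connected cut H connected) contains′))
      where
        contains′ : Contains (restrict H σ) (tupleSet v)
        contains′ _ (j , refl) = cong₂ _∧_ (contains _ (j , refl)) (inside j)

    uses-cut-edge : {σ : Fin n → Bool} {a b : Fin n} → IsCut G σ a b → ∀ {i j} →
      σ (v i) ≡ true → σ (v j) ≡ false → E H a b ≡ true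
    uses-cut-edge cut {i} {j} =
      cut-edge-on-walk cut H (connected (v i) (v j) (contains _ (i , refl)) (contains _ (j , refl)))

    cut-edge≡straddles : {σ : Fin n → Bool} {a b : Fin n} → IsCut G σ a b → E H a b ≡ straddles k (σ ∘ v)
    cut-edge≡straddles {σ} {a} {b} cut with straddles k (σ ∘ v) in str
    ... | true with anyᵇ⇒∃ k (∧-conicalˡ _ _ str) | anyᵇ⇒∃ k (∧-conicalʳ (anyᵇ k (σ ∘ v)) _ str)
    ...   | i , σi | j , σj = uses-cut-edge cut σi (not-injective σj)
    cut-edge≡straddles {σ} {a} {b} cut | false with ∧-false⇒ str
    ...   | inj₁ none = trans (Esym H a b)
                          (avoids-cut-edge (IsCut-complement cut) (λ j → cong not (anyᵇ-false⇒ k none j)))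
    ...   | inj₂ none = avoids-cut-edge cut (λ j → not-injective (anyᵇ-false⇒ k none j))

  steinerDistance≡cutCount : Acyclic G → {D : (Fin k → Fin n) → ℕ} → IsSteinerHypermatrix G D →
    ∀ v → D v ≡ cutCount (isEdge G) (side G) v
  steinerDistance≡cutCount {k = k} acyclic isD v with isD v
  ... | (H , connected , contains , count≡D) , D≤ =
    trans (sym count≡D) (sumℕ-cong n λ a → sumℕ-cong n λ b →
      cong ⟦_⟧ℕ (trans (cong (a <ᶠ b ∧_) (edges a b)) (sym (∧-assoc (a <ᶠ b) _ _))))
    where
      open MinimalSubgraph H connected contains (λ H′ c s → subst (_≤ edgeCount H′) (sym count≡D) (D≤ H′ c s))
      edges : ∀ a b → E H a b ≡ adj G a b ∧ straddles k (side G a b ∘ v)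
      edges a b with adj G a b in ab
      ... | true  = cut-edge≡straddles (side-cut acyclic ab)
      ... | false = E⊆G-false H ab

record Path₃ (G : Graph n) : Set where
  field
    u v w : Fin n
    uv    : adj G u v ≡ true
    vw    : adj G v w ≡ true
    u≢w   : u ≢ w

walk-enters : (E : Fin n → Fin n → Bool) (X : Fin n → Bool) {c t : Fin n} → Reach E c t →
  X c ≡ false → X t ≡ true → ∃₂ λ z z′ → X z ≡ false × X z′ ≡ true × E z z′ ≡ true
walk-enters E X here Xc Xt with trans (sym Xc) Xt
... | ()
walk-enters E X (step {u} {w} uw walk) Xu Xt with X w in Xw
... | true  = u , w , Xu , Xw , uw
... | false = walk-enters E X walk Xw Xt

module _ (G : Graph n) (connected : Connected G) {x y : Fin n} (xy : adj G x y ≡ true) where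

  private
    X : Fin n → Bool
    X z = z ≟ᵇ x ∨ z ≟ᵇ y

  -- a walk from a third vertex c enters {x, y} along an edge that extends xy to a path
  extend-edge : (c : Fin n) → c ≢ x → c ≢ y → Path₃ G
  extend-edge c c≢x c≢y with walk-enters (adj G) X (connected c y) Xc Xy
    where
      Xc : X c ≡ false
      Xc rewrite ≢⇒≟ᵇ-false c≢x | ≢⇒≟ᵇ-false c≢y = refl
      Xy : X y ≡ true
      Xy rewrite ≟ᵇ-refl y = ∨-zeroʳ _
  ... | z , z′ , Xz , Xz′ , zz′ with ∨-true⇒ Xz′
  ...   | inj₁ z′≟x = record
    { u = y ; v = x ; w = z ; uv = trans (Graph.sym G y x) xy
    ; vw = trans (Graph.sym G x z) (subst (λ q → adj G z q ≡ true) (≟ᵇ⇒≡ z′≟x) zz′)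
    ; u≢w = λ y≡z → ≟ᵇ-false⇒≢ (∨-conicalʳ _ _ Xz) (sym y≡z) }
  ...   | inj₂ z′≟y = record
    { u = x ; v = y ; w = z ; uv = xy
    ; vw = trans (Graph.sym G y z) (subst (λ q → adj G z q ≡ true) (≟ᵇ⇒≡ z′≟y) zz′)
    ; u≢w = λ x≡z → ≟ᵇ-false⇒≢ (∨-conicalˡ _ _ Xz) (sym x≡z) }

connected⇒Path₃ : (G : Graph (3 +ℕ n)) → Connected G → Path₃ G
connected⇒Path₃ G connected with connected zero (suc zero)
... | step {w = y} 0y _ with y ≟ suc zero
...   | yes refl = extend-edge G connected 0y (suc (suc zero)) (λ ()) (λ ())
...   | no  y≢1  = extend-edge G connected 0y (suc zero) (λ ()) (λ 1≡y → y≢1 (sym 1≡y))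

module RingCalculus {c ℓ : Level} (K : CommutativeRing c ℓ) where

  open CommutativeRing K hiding (zero) renaming (refl to ≈-refl; sym to ≈-sym; trans to ≈-trans; reflexive to ≈-reflexive)
  open RingProperties ring using (-‿distribˡ-*; -‿distribʳ-*; -‿involutive; -‿+-comm; -0#≈0#; +-inverseˡ-unique; +-inverseʳ-unique)
  open SumProperties semiring using (sum; sum-cong-≋; sum-replicate-zero; ∑-distrib-+; *-distribˡ-sum; *-distribʳ-sum)
  open ExpProperties commutativeSemiring using (_^_; ^-congˡ; ^-assocʳ)
  open SemiringSolver commutativeSemiring using (solve; _:=_; _:+_; _:*_)
  open CommutativeSemigroupProperties *-commutativeSemigroup using (x∙yz≈y∙xz) renaming (interchange to *-interchange)
  open SetoidReasoning setoid

  sumK≡sum : ∀ n (f : Fin n → Carrier) → sumK K n f ≡ sum f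
  sumK≡sum zero    f = refl
  sumK≡sum (suc n) f = cong (f zero +_) (sumK≡sum n (f ∘ suc))

  sumK-cong : ∀ n {f g : Fin n → Carrier} → (∀ i → f i ≈ g i) → sumK K n f ≈ sumK K n g
  sumK-cong n {f} {g} f≈g rewrite sumK≡sum n f | sumK≡sum n g = sum-cong-≋ f≈g

  sumK-zero : ∀ n → sumK K n (λ _ → 0#) ≈ 0#
  sumK-zero n rewrite sumK≡sum n (λ _ → 0#) = sum-replicate-zero n

  sumK-distrib-+ : ∀ n (f g : Fin n → Carrier) → sumK K n (λ i → f i + g i) ≈ sumK K n f + sumK K n g
  sumK-distrib-+ n f g rewrite sumK≡sum n (λ i → f i + g i) | sumK≡sum n f | sumK≡sum n g = ∑-distrib-+ f g

  *-distribˡ-sumK : ∀ n a (f : Fin n → Carrier) → a * sumK K n f ≈ sumK K n (λ i → a * f i)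
  *-distribˡ-sumK n a f rewrite sumK≡sum n f | sumK≡sum n (λ i → a * f i) = *-distribˡ-sum a f

  *-distribʳ-sumK : ∀ n a (f : Fin n → Carrier) → sumK K n f * a ≈ sumK K n (λ i → f i * a)
  *-distribʳ-sumK n a f rewrite sumK≡sum n f | sumK≡sum n (λ i → f i * a) = *-distribʳ-sum a f

  -‿sumK : ∀ n (f : Fin n → Carrier) → - sumK K n f ≈ sumK K n (λ i → - f i)
  -‿sumK zero    f = -0#≈0#
  -‿sumK (suc n) f = ≈-trans (≈-sym (-‿+-comm _ _)) (+-congˡ (-‿sumK n (f ∘ suc)))

  sumK-comm : ∀ n m (f : Fin n → Fin m → Carrier) →
    sumK K n (λ i → sumK K m (f i)) ≈ sumK K m (λ j → sumK K n (λ i → f i j))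
  sumK-comm zero    m f = ≈-sym (sumK-zero m)
  sumK-comm (suc n) m f = ≈-trans (+-congˡ (sumK-comm n m (f ∘ suc))) (≈-sym (sumK-distrib-+ m _ _))

  sumK² : ∀ n → (Fin n → Fin n → Carrier) → Carrier
  sumK² n f = sumK K n (λ a → sumK K n (f a))

  sumK²-cong : ∀ n {f g : Fin n → Fin n → Carrier} → (∀ a b → f a b ≈ g a b) → sumK² n f ≈ sumK² n g
  sumK²-cong n f≈g = sumK-cong n (λ a → sumK-cong n (f≈g a))

  sumK²-distrib-+ : ∀ n (f g : Fin n → Fin n → Carrier) → sumK² n (λ a b → f a b + g a b) ≈ sumK² n f + sumK² n g
  sumK²-distrib-+ n f g = ≈-trans (sumK-cong n (λ a → sumK-distrib-+ n (f a) (g a)))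
                                  (sumK-distrib-+ n (λ a → sumK K n (f a)) (λ a → sumK K n (g a)))

  *-distribˡ-sumK² : ∀ n c (f : Fin n → Fin n → Carrier) → c * sumK² n f ≈ sumK² n (λ a b → c * f a b)
  *-distribˡ-sumK² n c f = ≈-trans (*-distribˡ-sumK n c (λ a → sumK K n (f a))) (sumK-cong n (λ a → *-distribˡ-sumK n c (f a)))

  *-distribʳ-sumK² : ∀ n c (f : Fin n → Fin n → Carrier) → sumK² n f * c ≈ sumK² n (λ a b → f a b * c)
  *-distribʳ-sumK² n c f = ≈-trans (*-distribʳ-sumK n c (λ a → sumK K n (f a))) (sumK-cong n (λ a → *-distribʳ-sumK n c (f a)))

  -‿sumK² : ∀ n (f : Fin n → Fin n → Carrier) → - sumK² n f ≈ sumK² n (λ a b → - f a b)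
  -‿sumK² n f = ≈-trans (-‿sumK n (λ a → sumK K n (f a))) (sumK-cong n (λ a → -‿sumK n (f a)))

  sumK²-*-neg : ∀ n c (g p : Fin n → Fin n → Carrier) →
    sumK² n (λ a b → g a b * - (c * p a b)) ≈ - (c * sumK² n (λ a b → g a b * p a b))
  sumK²-*-neg n c g p = begin
    sumK² n (λ a b → g a b * - (c * p a b))
      ≈⟨ sumK²-cong n (λ a b → ≈-trans (≈-sym (-‿distribʳ-* (g a b) (c * p a b))) (-‿cong (x∙yz≈y∙xz _ _ _))) ⟩
    sumK² n (λ a b → - (c * (g a b * p a b)))
      ≈⟨ -‿sumK² n (λ a b → c * (g a b * p a b)) ⟨
    - sumK² n (λ a b → c * (g a b * p a b))
      ≈⟨ -‿cong (*-distribˡ-sumK² n c (λ a b → g a b * p a b)) ⟨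
    - (c * sumK² n (λ a b → g a b * p a b))
      ∎

  ⟦_⟧ : Bool → Carrier
  ⟦ b ⟧ = if b then 1# else 0#

  ⟦⟧-∧ : ∀ a b → ⟦ a ∧ b ⟧ ≈ ⟦ a ⟧ * ⟦ b ⟧
  ⟦⟧-∧ true  b = ≈-sym (*-identityˡ _)
  ⟦⟧-∧ false b = ≈-sym (zeroˡ _)

  ⟦⟧-+-⟦not⟧ : ∀ b → ⟦ b ⟧ + ⟦ not b ⟧ ≈ 1#
  ⟦⟧-+-⟦not⟧ true  = +-identityʳ _
  ⟦⟧-+-⟦not⟧ false = +-identityˡ _

  ⟦⟧-partition : ∀ p q → p ∧ q ≡ false → ⟦ not q ∧ not p ⟧ + (⟦ p ⟧ + ⟦ q ⟧) ≈ 1#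
  ⟦⟧-partition true  false _ = ≈-trans (+-identityˡ _) (+-identityʳ _)
  ⟦⟧-partition false true  _ = ≈-trans (+-identityˡ _) (+-identityˡ _)
  ⟦⟧-partition false false _ = ≈-trans (+-congˡ (+-identityˡ _)) (+-identityʳ _)

  ⟦⟧-true : ∀ {b} y → b ≡ true → ⟦ b ⟧ * y ≈ y
  ⟦⟧-true y refl = *-identityˡ y

  if-0# : ∀ b y → (if b then y else 0#) ≈ ⟦ b ⟧ * y
  if-0# true  y = ≈-sym (*-identityˡ y)
  if-0# false y = ≈-sym (zeroˡ y)

  if-*-0# : ∀ b y z → (if b then y * z else 0#) ≈ y * (if b then z else 0#)
  if-*-0# true  y z = ≈-refl
  if-*-0# false y z = ≈-sym (zeroʳ y)

  sumK-select : ∀ n (a : Fin n) (f : Fin n → Carrier) → sumK K n (λ i → ⟦ i ≟ᵇ a ⟧ * f i) ≈ f a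
  sumK-select (suc n) zero    f = begin
    1# * f zero + sumK K n (λ i → 0# * f (suc i)) ≈⟨ +-cong (*-identityˡ _) (sumK-cong n (λ i → zeroˡ _)) ⟩
    f zero + sumK K n (λ _ → 0#)                   ≈⟨ +-congˡ (sumK-zero n) ⟩
    f zero + 0#                                    ≈⟨ +-identityʳ _ ⟩
    f zero                                         ∎
  sumK-select (suc n) (suc a) f = ≈-trans (+-cong (zeroˡ _) (sumK-select n a (f ∘ suc))) (+-identityˡ _)

  ℕ→K-+ : ∀ a b → ℕ→K K (a +ℕ b) ≈ ℕ→K K a + ℕ→K K b
  ℕ→K-+ zero    b = ≈-sym (+-identityˡ _)
  ℕ→K-+ (suc a) b = ≈-trans (+-congˡ (ℕ→K-+ a b)) (≈-sym (+-assoc _ _ _))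

  ℕ→K-sumℕ : ∀ n (f : Fin n → ℕ) → ℕ→K K (sumℕ n f) ≈ sumK K n (ℕ→K K ∘ f)
  ℕ→K-sumℕ zero    f = ≈-refl
  ℕ→K-sumℕ (suc n) f = ≈-trans (ℕ→K-+ (f zero) _) (+-congˡ (ℕ→K-sumℕ n (f ∘ suc)))

  ℕ→K-⟦⟧ℕ : ∀ b → ℕ→K K ⟦ b ⟧ℕ ≈ ⟦ b ⟧
  ℕ→K-⟦⟧ℕ true  = +-identityʳ _
  ℕ→K-⟦⟧ℕ false = ≈-refl

  sumTuples-cong : ∀ k n {f g : (Fin k → Fin n) → Carrier} → (∀ v → f v ≈ g v) → sumTuples K k n f ≈ sumTuples K k n g
  sumTuples-cong zero    n f≈g = f≈g _
  sumTuples-cong (suc k) n f≈g = sumK-cong n (λ a → sumTuples-cong k n (f≈g ∘ cons K a))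

  sumTuples-distrib-+ : ∀ k n (f g : (Fin k → Fin n) → Carrier) →
    sumTuples K k n (λ v → f v + g v) ≈ sumTuples K k n f + sumTuples K k n g
  sumTuples-distrib-+ zero    n f g = ≈-refl
  sumTuples-distrib-+ (suc k) n f g =
    ≈-trans (sumK-cong n (λ a → sumTuples-distrib-+ k n _ _)) (sumK-distrib-+ n _ _)

  *-distribˡ-sumTuples : ∀ k n a (f : (Fin k → Fin n) → Carrier) →
    a * sumTuples K k n f ≈ sumTuples K k n (λ v → a * f v)
  *-distribˡ-sumTuples zero    n a f = ≈-refl
  *-distribˡ-sumTuples (suc k) n a f = ≈-trans (*-distribˡ-sumK n a _) (sumK-cong n (λ b → *-distribˡ-sumTuples k n a _))

  sumTuples-sumK-comm : ∀ k n m (f : (Fin k → Fin n) → Fin m → Carrier) →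
    sumTuples K k n (λ v → sumK K m (f v)) ≈ sumK K m (λ a → sumTuples K k n (λ v → f v a))
  sumTuples-sumK-comm zero    n m f = ≈-refl
  sumTuples-sumK-comm (suc k) n m f =
    ≈-trans (sumK-cong n (λ b → sumTuples-sumK-comm k n m _)) (sumK-comm n m _)

  sumTuples-sumK²-* : ∀ k n (g : Fin n → Fin n → Carrier) (f : Fin n → Fin n → (Fin k → Fin n) → Carrier)
    (q : (Fin k → Fin n) → Carrier) →
    sumTuples K k n (λ v → sumK² n (λ a b → g a b * f a b v) * q v)
      ≈ sumK² n (λ a b → g a b * sumTuples K k n (λ v → f a b v * q v))
  sumTuples-sumK²-* k n g f q = begin
    sumTuples K k n (λ v → sumK² n (λ a b → g a b * f a b v) * q v)
      ≈⟨ sumTuples-cong k n (λ v → ≈-trans (*-distribʳ-sumK² n (q v) _) (sumK²-cong n (λ a b → *-assoc _ _ _))) ⟩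
    sumTuples K k n (λ v → sumK² n (λ a b → g a b * (f a b v * q v)))
      ≈⟨ ≈-trans (sumTuples-sumK-comm k n n (λ v a → sumK K n (λ b → g a b * (f a b v * q v))))
                 (sumK-cong n (λ a → sumTuples-sumK-comm k n n (λ v b → g a b * (f a b v * q v)))) ⟩
    sumK² n (λ a b → sumTuples K k n (λ v → g a b * (f a b v * q v)))
      ≈⟨ sumK²-cong n (λ a b → *-distribˡ-sumTuples k n (g a b) (λ v → f a b v * q v)) ⟨
    sumK² n (λ a b → g a b * sumTuples K k n (λ v → f a b v * q v))
      ∎

  powK≡^ : ∀ y e → powK K y e ≡ y ^ e
  powK≡^ y zero    = refl
  powK≡^ y (suc e) = cong (y *_) (powK≡^ y e)

  1#^ : ∀ e → 1# ^ e ≈ 1#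
  1#^ zero    = ≈-refl
  1#^ (suc e) = ≈-trans (*-identityˡ _) (1#^ e)

  -^-even : ∀ y h → (- y) ^ (2 *ℕ h) ≈ y ^ (2 *ℕ h)
  -^-even y h = begin
    (- y) ^ (2 *ℕ h)  ≈⟨ ^-assocʳ (- y) 2 h ⟨
    ((- y) ^ 2) ^ h   ≈⟨ ^-congˡ h neg-square ⟩
    (y ^ 2) ^ h       ≈⟨ ^-assocʳ y 2 h ⟩
    y ^ (2 *ℕ h)      ∎
    where
      neg-square : (- y) ^ 2 ≈ y ^ 2
      neg-square = begin
        - y * (- y * 1#)  ≈⟨ *-congˡ (*-identityʳ _) ⟩
        - y * - y         ≈⟨ -‿distribˡ-* y (- y) ⟨
        - (y * - y)       ≈⟨ -‿cong (-‿distribʳ-* y y) ⟨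
        - - (y * y)       ≈⟨ -‿involutive _ ⟩
        y * y             ≈⟨ *-congˡ (*-identityʳ _) ⟨
        y * (y * 1#)      ∎

  ∃-root-of-minus-one : IsAlgClosedChar0Field K → ∀ e → .{{NonZero e}} → ∃ λ γ → γ ^ e ≈ - 1#
  ∃-root-of-minus-one closed (suc d) = γ , +-inverseˡ-unique _ _ (begin
    γ ^ suc d + 1#
      ≈⟨ +-cong (≈-reflexive (powK≡^ γ (suc d))) constant-term ⟨
    powK K γ (suc d) + sumK K (suc d) (λ i → coefficient i * powK K γ (toℕ i))
      ≈⟨ proj₂ root ⟩
    0# ∎)
    where
      coefficient : Fin (suc d) → Carrier
      coefficient zero    = 1#
      coefficient (suc _) = 0#
      root : ∃ λ y → powK K y (suc d) + sumK K (suc d) (λ i → coefficient i * powK K y (toℕ i)) ≈ 0#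
      root = IsAlgClosedChar0Field.algClosed closed d coefficient
      γ : Carrier
      γ = proj₁ root
      constant-term : sumK K (suc d) (λ i → coefficient i * powK K γ (toℕ i)) ≈ 1#
      constant-term = ≈-trans (+-cong (*-identityˡ 1#) (≈-trans (sumK-cong d (λ _ → zeroˡ _)) (sumK-zero d)))
                              (+-identityʳ 1#)

  module Pairing {n : ℕ} (x : Fin n → Carrier) where

    ⟨_⟩ : (Fin n → Carrier) → Carrier
    ⟨ c ⟩ = sumK K n (λ z → c z * x z)

    ⟨⟩-complement : ∀ (σ : Fin n → Bool) → ⟨ ⟦_⟧ ∘ σ ⟩ + ⟨ ⟦_⟧ ∘ not ∘ σ ⟩ ≈ ⟨ (λ _ → 1#) ⟩
    ⟨⟩-complement σ = ≈-trans (≈-sym (sumK-distrib-+ n _ _))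
      (sumK-cong n (λ z → ≈-trans (≈-sym (distribʳ (x z) _ _)) (*-congʳ (⟦⟧-+-⟦not⟧ (σ z)))))

  module Derivative {n : ℕ} (x : Fin n → Carrier) (m : Fin n) where

    open Pairing x public

    monomial : ∀ k → (Fin k → Fin n) → Carrier
    monomial k v = prodK K k (x ∘ v)

    ∂monomial : ∀ k → (Fin k → Fin n) → Carrier
    ∂monomial k v = sumK K k (λ j →
      if v j ≟ᵇ m then prodK K k (λ j′ → if j ≟ᵇ j′ then 1# else x (v j′)) else 0#)

    weight : (Fin n → Carrier) → ∀ k → (Fin k → Fin n) → Carrier
    weight c k v = prodK K k (c ∘ v)

    ∂monomial-cons : ∀ k a v → ∂monomial (suc k) (cons K a v) ≈ ⟦ a ≟ᵇ m ⟧ * monomial k v + x a * ∂monomial k v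
    ∂monomial-cons k a v = +-cong
      (≈-trans (if-0# (a ≟ᵇ m) _) (*-congˡ (*-identityˡ _)))
      (≈-trans (sumK-cong k (λ j → if-*-0# (v j ≟ᵇ m) (x a) _)) (≈-sym (*-distribˡ-sumK k (x a) _)))

    sum-weighted-monomial : ∀ k c → sumTuples K k n (λ v → weight c k v * monomial k v) ≈ ⟨ c ⟩ ^ k
    sum-weighted-monomial zero    c = *-identityˡ 1#
    sum-weighted-monomial (suc k) c = begin
      sumK K n (λ a → sumTuples K k n (λ v → (c a * weight c k v) * (x a * monomial k v)))
        ≈⟨ sumK-cong n (λ a → sumTuples-cong k n (λ v → *-interchange _ _ _ _)) ⟩
      sumK K n (λ a → sumTuples K k n (λ v → (c a * x a) * (weight c k v * monomial k v)))
        ≈⟨ sumK-cong n (λ a → ≈-sym (*-distribˡ-sumTuples k n _ _)) ⟩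
      sumK K n (λ a → (c a * x a) * sumTuples K k n (λ v → weight c k v * monomial k v))
        ≈⟨ sumK-cong n (λ a → *-congˡ (sum-weighted-monomial k c)) ⟩
      sumK K n (λ a → (c a * x a) * ⟨ c ⟩ ^ k)
        ≈⟨ *-distribʳ-sumK n _ _ ⟨
      ⟨ c ⟩ * ⟨ c ⟩ ^ k
        ∎

    -- the derivative of ⟨ c ⟩ ^ k with respect to x m
    weighted-∂ : (Fin n → Carrier) → ℕ → Carrier
    weighted-∂ c k = sumTuples K k n (λ v → weight c k v * ∂monomial k v)

    weighted-∂-suc : ∀ k c → weighted-∂ c (suc k) ≈ c m * ⟨ c ⟩ ^ k + ⟨ c ⟩ * weighted-∂ c k
    weighted-∂-suc k c = begin
      sumK K n (λ a → sumTuples K k n (λ v → (c a * weight c k v) * ∂monomial (suc k) (cons K a v)))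
        ≈⟨ sumK-cong n (λ a → sumTuples-cong k n (λ v → ≈-trans (*-congˡ (∂monomial-cons k a v)) (expand _ _ _ _ _ _))) ⟩
      sumK K n (λ a → sumTuples K k n (λ v →
        ⟦ a ≟ᵇ m ⟧ * c a * (weight c k v * monomial k v) + (c a * x a) * (weight c k v * ∂monomial k v)))
        ≈⟨ sumK-cong n (λ a → ≈-trans (sumTuples-distrib-+ k n _ _)
             (+-cong (≈-sym (*-distribˡ-sumTuples k n _ _)) (≈-sym (*-distribˡ-sumTuples k n _ _)))) ⟩
      sumK K n (λ a → ⟦ a ≟ᵇ m ⟧ * c a * sumTuples K k n (λ v → weight c k v * monomial k v)
                      + (c a * x a) * weighted-∂ c k)
        ≈⟨ sumK-distrib-+ n _ _ ⟩
      sumK K n (λ a → ⟦ a ≟ᵇ m ⟧ * c a * sumTuples K k n (λ v → weight c k v * monomial k v))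
        + sumK K n (λ a → (c a * x a) * weighted-∂ c k)
        ≈⟨ +-cong (≈-trans (sumK-cong n (λ a → *-assoc _ _ _)) (sumK-select n m _))
                  (≈-sym (*-distribʳ-sumK n _ _)) ⟩
      c m * sumTuples K k n (λ v → weight c k v * monomial k v) + ⟨ c ⟩ * weighted-∂ c k
        ≈⟨ +-congʳ (*-congˡ (sum-weighted-monomial k c)) ⟩
      c m * ⟨ c ⟩ ^ k + ⟨ c ⟩ * weighted-∂ c k
        ∎
      where
        expand : ∀ ca w i p xa q → (ca * w) * (i * p + xa * q) ≈ i * ca * (w * p) + (ca * xa) * (w * q)
        expand = solve 6 (λ ca w i p xa q →
          (ca :* w) :* (i :* p :+ xa :* q) := i :* ca :* (w :* p) :+ (ca :* xa) :* (w :* q)) ≈-refl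

    sum-weighted-∂monomial : ∀ k c → weighted-∂ c (suc k) ≈ ℕ→K K (suc k) * (c m * ⟨ c ⟩ ^ k)
    sum-weighted-∂monomial zero c = begin
      weighted-∂ c 1                       ≈⟨ weighted-∂-suc zero c ⟩
      c m * 1# + ⟨ c ⟩ * (1# * 0#)         ≈⟨ +-congˡ (≈-trans (*-congˡ (*-identityˡ 0#)) (zeroʳ _)) ⟩
      c m * 1# + 0#                        ≈⟨ +-identityʳ _ ⟩
      c m * 1#                             ≈⟨ *-identityˡ _ ⟨
      1# * (c m * 1#)                      ≈⟨ *-congʳ (+-identityʳ 1#) ⟨
      ℕ→K K 1 * (c m * ⟨ c ⟩ ^ zero)       ∎
    sum-weighted-∂monomial (suc k) c = begin
      weighted-∂ c (suc (suc k))
        ≈⟨ weighted-∂-suc (suc k) c ⟩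
      c m * ⟨ c ⟩ ^ suc k + ⟨ c ⟩ * weighted-∂ c (suc k)
        ≈⟨ +-cong (≈-sym (*-identityˡ _)) (*-congˡ (sum-weighted-∂monomial k c)) ⟩
      1# * (c m * ⟨ c ⟩ ^ suc k) + ⟨ c ⟩ * (ℕ→K K (suc k) * (c m * ⟨ c ⟩ ^ k))
        ≈⟨ +-congˡ (rearrange (c m) ⟨ c ⟩ (⟨ c ⟩ ^ k) (ℕ→K K (suc k))) ⟩
      1# * (c m * ⟨ c ⟩ ^ suc k) + ℕ→K K (suc k) * (c m * ⟨ c ⟩ ^ suc k)
        ≈⟨ distribʳ _ _ _ ⟨
      ℕ→K K (suc (suc k)) * (c m * ⟨ c ⟩ ^ suc k)
        ∎
      where
        rearrange : ∀ cm S P N → S * (N * (cm * P)) ≈ N * (cm * (S * P))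
        rearrange = solve 4 (λ cm S P N → S :* (N :* (cm :* P)) := N :* (cm :* (S :* P))) ≈-refl

    weighted-∂-vanishes : ∀ k .{{_ : NonZero k}} c → ⟨ c ⟩ ≈ 0# → weighted-∂ c (suc k) ≈ 0#
    weighted-∂-vanishes (suc k) c ⟨c⟩≈0 = begin
      weighted-∂ c (suc (suc k))                 ≈⟨ sum-weighted-∂monomial (suc k) c ⟩
      ℕ→K K (suc (suc k)) * (c m * ⟨ c ⟩ ^ suc k) ≈⟨ *-congˡ (*-congˡ (≈-trans (*-congʳ ⟨c⟩≈0) (zeroˡ _))) ⟩
      ℕ→K K (suc (suc k)) * (c m * 0#)           ≈⟨ ≈-trans (*-congˡ (zeroʳ _)) (zeroʳ _) ⟩
      0#                                         ∎

    weight-⟦⟧ : ∀ k (σ : Fin n → Bool) v → weight (⟦_⟧ ∘ σ) k v ≈ ⟦ allᵇ k (σ ∘ v) ⟧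
    weight-⟦⟧ zero    σ v = ≈-refl
    weight-⟦⟧ (suc k) σ v = ≈-trans (*-congˡ (weight-⟦⟧ k σ (v ∘ suc))) (≈-sym (⟦⟧-∧ (σ (v zero)) _))

    weight-1# : ∀ k v → weight (λ _ → 1#) k v ≈ 1#
    weight-1# zero    v = ≈-refl
    weight-1# (suc k) v = ≈-trans (*-identityˡ _) (weight-1# k (v ∘ suc))

    -- a tuple either straddles σ or lies entirely on one side of it
    straddles-weights : ∀ k (σ : Fin n → Bool) v →
      ⟦ straddles (suc k) (σ ∘ v) ⟧ + (weight (⟦_⟧ ∘ σ) (suc k) v + weight (⟦_⟧ ∘ not ∘ σ) (suc k) v)
        ≈ weight (λ _ → 1#) (suc k) v
    straddles-weights k σ v = begin
      ⟦ anyᵇ (suc k) (σ ∘ v) ∧ anyᵇ (suc k) (not ∘ σ ∘ v) ⟧ + (Wσ + W¬σ)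
        ≡⟨ cong₂ (λ p q → ⟦ p ∧ q ⟧ + (Wσ + W¬σ))
             (anyᵇ≡not-allᵇ-not (suc k) (σ ∘ v)) (anyᵇ-not≡not-allᵇ (suc k) (σ ∘ v)) ⟩
      ⟦ not (allᵇ (suc k) (not ∘ σ ∘ v)) ∧ not (allᵇ (suc k) (σ ∘ v)) ⟧ + (Wσ + W¬σ)
        ≈⟨ +-congˡ (+-cong (weight-⟦⟧ (suc k) σ v) (weight-⟦⟧ (suc k) (not ∘ σ) v)) ⟩
      ⟦ not (allᵇ (suc k) (not ∘ σ ∘ v)) ∧ not (allᵇ (suc k) (σ ∘ v)) ⟧
        + (⟦ allᵇ (suc k) (σ ∘ v) ⟧ + ⟦ allᵇ (suc k) (not ∘ σ ∘ v) ⟧)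
        ≈⟨ ⟦⟧-partition _ _ (allᵇ-and-allᵇ-not k (σ ∘ v)) ⟩
      1#
        ≈⟨ weight-1# (suc k) v ⟨
      weight (λ _ → 1#) (suc k) v
        ∎
      where
        Wσ W¬σ : Carrier
        Wσ  = weight (⟦_⟧ ∘ σ) (suc k) v
        W¬σ = weight (⟦_⟧ ∘ not ∘ σ) (suc k) v

    straddling-∂ : ∀ k → (Fin n → Bool) → Carrier
    straddling-∂ k σ = sumTuples K k n (λ v → ⟦ straddles k (σ ∘ v) ⟧ * ∂monomial k v)

    straddling-∂-+-sides : ∀ k (σ : Fin n → Bool) →
      straddling-∂ (suc k) σ + (weighted-∂ (⟦_⟧ ∘ σ) (suc k) + weighted-∂ (⟦_⟧ ∘ not ∘ σ) (suc k))
        ≈ weighted-∂ (λ _ → 1#) (suc k)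
    straddling-∂-+-sides k σ = begin
      sumTuples K (suc k) n straddling + (sumTuples K (suc k) n inside + sumTuples K (suc k) n outside)
        ≈⟨ +-congˡ (sumTuples-distrib-+ (suc k) n inside outside) ⟨
      sumTuples K (suc k) n straddling + sumTuples K (suc k) n (λ v → inside v + outside v)
        ≈⟨ sumTuples-distrib-+ (suc k) n straddling (λ v → inside v + outside v) ⟨
      sumTuples K (suc k) n (λ v → straddling v + (inside v + outside v))
        ≈⟨ sumTuples-cong (suc k) n (λ v → ≈-trans (factor _ _ _ (∂monomial (suc k) v))
                                                 (*-congʳ (straddles-weights k σ v))) ⟩
      weighted-∂ (λ _ → 1#) (suc k)
        ∎
      where
        straddling inside outside : (Fin (suc k) → Fin n) → Carrier
        straddling v = ⟦ straddles (suc k) (σ ∘ v) ⟧ * ∂monomial (suc k) v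
        inside     v = weight (⟦_⟧ ∘ σ) (suc k) v * ∂monomial (suc k) v
        outside    v = weight (⟦_⟧ ∘ not ∘ σ) (suc k) v * ∂monomial (suc k) v
        factor : ∀ a b c q → a * q + (b * q + c * q) ≈ (a + (b + c)) * q
        factor = solve 4 (λ a b c q → a :* q :+ (b :* q :+ c :* q) := (a :+ (b :+ c)) :* q) ≈-refl

  module EvenPower (h : ℕ) where

    e : ℕ
    e = 2 *ℕ suc h

    module _ {n : ℕ} (x : Fin n → Carrier) (m : Fin n) where
      open Derivative x m

      -- the two sides have opposite pairings with x, and e is even
      sides-∂ : ∀ (σ : Fin n → Bool) → ⟨ (λ _ → 1#) ⟩ ≈ 0# →
        weighted-∂ (⟦_⟧ ∘ σ) (suc e) + weighted-∂ (⟦_⟧ ∘ not ∘ σ) (suc e) ≈ ℕ→K K (suc e) * ⟨ ⟦_⟧ ∘ σ ⟩ ^ e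
      sides-∂ σ ⟨1⟩≈0 = begin
        weighted-∂ (⟦_⟧ ∘ σ) (suc e) + weighted-∂ (⟦_⟧ ∘ not ∘ σ) (suc e)
          ≈⟨ +-cong (sum-weighted-∂monomial e _) (sum-weighted-∂monomial e _) ⟩
        N * (⟦ σ m ⟧ * ⟨ ⟦_⟧ ∘ σ ⟩ ^ e) + N * (⟦ not (σ m) ⟧ * ⟨ ⟦_⟧ ∘ not ∘ σ ⟩ ^ e)
          ≈⟨ +-congˡ (*-congˡ (*-congˡ complement-power)) ⟩
        N * (⟦ σ m ⟧ * ⟨ ⟦_⟧ ∘ σ ⟩ ^ e) + N * (⟦ not (σ m) ⟧ * ⟨ ⟦_⟧ ∘ σ ⟩ ^ e)
          ≈⟨ ≈-trans (≈-sym (distribˡ N _ _)) (*-congˡ (≈-sym (distribʳ _ _ _))) ⟩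
        N * ((⟦ σ m ⟧ + ⟦ not (σ m) ⟧) * ⟨ ⟦_⟧ ∘ σ ⟩ ^ e)
          ≈⟨ *-congˡ (≈-trans (*-congʳ (⟦⟧-+-⟦not⟧ (σ m))) (*-identityˡ _)) ⟩
        N * ⟨ ⟦_⟧ ∘ σ ⟩ ^ e
          ∎
        where
          N : Carrier
          N = ℕ→K K (suc e)
          complement-power : ⟨ ⟦_⟧ ∘ not ∘ σ ⟩ ^ e ≈ ⟨ ⟦_⟧ ∘ σ ⟩ ^ e
          complement-power = ≈-trans
            (^-congˡ e (+-inverseʳ-unique _ _ (≈-trans (⟨⟩-complement σ) ⟨1⟩≈0)))
            (-^-even ⟨ ⟦_⟧ ∘ σ ⟩ (suc h))

      straddling-∂≈ : ∀ (σ : Fin n → Bool) → ⟨ (λ _ → 1#) ⟩ ≈ 0# →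
        straddling-∂ (suc e) σ ≈ - (ℕ→K K (suc e) * ⟨ ⟦_⟧ ∘ σ ⟩ ^ e)
      straddling-∂≈ σ ⟨1⟩≈0 = +-inverseˡ-unique _ _ (begin
        straddling-∂ (suc e) σ + ℕ→K K (suc e) * ⟨ ⟦_⟧ ∘ σ ⟩ ^ e
          ≈⟨ +-congˡ (sides-∂ σ ⟨1⟩≈0) ⟨
        straddling-∂ (suc e) σ + (weighted-∂ (⟦_⟧ ∘ σ) (suc e) + weighted-∂ (⟦_⟧ ∘ not ∘ σ) (suc e))
          ≈⟨ straddling-∂-+-sides e σ ⟩
        weighted-∂ (λ _ → 1#) (suc e)
          ≈⟨ weighted-∂-vanishes e (λ _ → 1#) ⟨1⟩≈0 ⟩
        0#
          ∎)

  prodK-cong : ∀ k {f g : Fin k → Carrier} → (∀ i → f i ≈ g i) → prodK K k f ≈ prodK K k g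
  prodK-cong zero    f≈g = ≈-refl
  prodK-cong (suc k) f≈g = *-cong (f≈g zero) (prodK-cong k (f≈g ∘ suc))

  -- partialF tests equality of indices with a function local to its definition, so the conditions
  -- of the two case analyses below are left to unification (M and m are only there to solve them).
  mutual
    partialF≈ : ∀ k n M (x : Fin n → Carrier) m →
      partialF K k n M x m ≈ sumTuples K k n (λ v → ℕ→K K (M v) * Derivative.∂monomial x m k v)
    partialF≈ k n M x m = sumTuples-cong k n (λ v → *-congˡ (sumK-cong k (partialF-summand M x m v)))

    partialF-summand : ∀ {k n} (M : (Fin k → Fin n) → ℕ) (x : Fin n → Carrier) m (v : Fin k → Fin n) j →
      (if _ then prodK K k _ else 0#) ≈ (if v j ≟ᵇ m then prodK K k (λ j′ → if j ≟ᵇ j′ then 1# else x (v j′)) else 0#)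
    partialF-summand {k} M x m v j with v j ≟ m
    ... | yes _ = prodK-cong k (partialF-factor M x m v j)
    ... | no  _ = ≈-refl

    partialF-factor : ∀ {k n} (M : (Fin k → Fin n) → ℕ) (x : Fin n → Carrier) m (v : Fin k → Fin n) j j′ →
      (if _ then 1# else x (v j′)) ≈ (if j ≟ᵇ j′ then 1# else x (v j′))
    partialF-factor M x m v j j′ with j ≟ j′
    ... | yes _ = ≈-refl
    ... | no  _ = ≈-refl

  ℕ→K-cutCount : ∀ {n k} (select : Fin n → Fin n → Bool) (part : Fin n → Fin n → Fin n → Bool) (v : Fin k → Fin n) →
    ℕ→K K (cutCount select part v) ≈ sumK² n (λ a b → ⟦ select a b ⟧ * ⟦ straddles k (part a b ∘ v) ⟧)
  ℕ→K-cutCount {n} {k} select part v = ≈-trans (ℕ→K-sumℕ n _) (sumK-cong n (λ a →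
    ≈-trans (ℕ→K-sumℕ n _) (sumK-cong n (λ b →
      ≈-trans (ℕ→K-⟦⟧ℕ _) (⟦⟧-∧ (select a b) (straddles k (part a b ∘ v)))))))

  module Gradient {n : ℕ} (x : Fin n → Carrier) (m : Fin n) (h : ℕ) where
    open EvenPower h
    open Derivative x m

    partialF-cutCount : (select : Fin n → Fin n → Bool) (part : Fin n → Fin n → Fin n → Bool)
      (M : (Fin (suc e) → Fin n) → ℕ) → (∀ v → M v ≡ cutCount select part v) → ⟨ (λ _ → 1#) ⟩ ≈ 0# →
      partialF K (suc e) n M x m ≈ - (ℕ→K K (suc e) * sumK² n (λ a b → ⟦ select a b ⟧ * ⟨ ⟦_⟧ ∘ part a b ⟩ ^ e))
    partialF-cutCount select part M M≡cutCount ⟨1⟩≈0 = begin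
      partialF K (suc e) n M x m
        ≈⟨ partialF≈ (suc e) n M x m ⟩
      sumTuples K (suc e) n (λ v → ℕ→K K (M v) * ∂monomial (suc e) v)
        ≈⟨ sumTuples-cong (suc e) n {f = λ v → ℕ→K K (M v) * ∂monomial (suc e) v}
             (λ v → *-cong (≈-trans (≈-reflexive (cong (ℕ→K K) (M≡cutCount v))) (ℕ→K-cutCount select part v)) ≈-refl) ⟩
      sumTuples K (suc e) n (λ v → sumK² n (λ a b → ⟦ select a b ⟧ * straddling a b v) * ∂monomial (suc e) v)
        ≈⟨ sumTuples-sumK²-* (suc e) n (λ a b → ⟦ select a b ⟧) straddling (∂monomial (suc e)) ⟩
      sumK² n (λ a b → ⟦ select a b ⟧ * straddling-∂ (suc e) (part a b))
        ≈⟨ sumK²-cong n (λ a b → *-congˡ (straddling-∂≈ x m (part a b) ⟨1⟩≈0)) ⟩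
      sumK² n (λ a b → ⟦ select a b ⟧ * - (ℕ→K K (suc e) * power a b))
        ≈⟨ sumK²-*-neg n (ℕ→K K (suc e)) (λ a b → ⟦ select a b ⟧) power ⟩
      - (ℕ→K K (suc e) * sumK² n (λ a b → ⟦ select a b ⟧ * power a b))
        ∎
      where
        straddling : Fin n → Fin n → (Fin (suc e) → Fin n) → Carrier
        straddling a b v = ⟦ straddles (suc e) (part a b ∘ v) ⟧
        power : Fin n → Fin n → Carrier
        power a b = ⟨ ⟦_⟧ ∘ part a b ⟩ ^ e

  ⟦⟧-∧-∨ : ∀ c a₁ b₁ a₂ b₂ → a₁ ∧ a₂ ≡ false →
    ⟦ c ∧ (a₁ ∧ b₁ ∨ a₂ ∧ b₂) ⟧ ≈ ⟦ a₁ ⟧ * (⟦ b₁ ⟧ * ⟦ c ⟧) + ⟦ a₂ ⟧ * (⟦ b₂ ⟧ * ⟦ c ⟧)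
  ⟦⟧-∧-∨ c true b₁ false b₂ _ = begin
    ⟦ c ∧ (b₁ ∨ false) ⟧                        ≡⟨ cong (λ q → ⟦ c ∧ q ⟧) (∨-identityʳ b₁) ⟩
    ⟦ c ∧ b₁ ⟧                                  ≈⟨ ≈-trans (⟦⟧-∧ c b₁) (*-comm _ _) ⟩
    ⟦ b₁ ⟧ * ⟦ c ⟧                              ≈⟨ ≈-trans (+-cong (*-identityˡ _) (zeroˡ _)) (+-identityʳ _) ⟨
    1# * (⟦ b₁ ⟧ * ⟦ c ⟧) + 0# * (⟦ b₂ ⟧ * ⟦ c ⟧) ∎
  ⟦⟧-∧-∨ c false b₁ true b₂ _ = begin
    ⟦ c ∧ b₂ ⟧                                  ≈⟨ ≈-trans (⟦⟧-∧ c b₂) (*-comm _ _) ⟩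
    ⟦ b₂ ⟧ * ⟦ c ⟧                              ≈⟨ ≈-trans (+-cong (zeroˡ _) (*-identityˡ _)) (+-identityˡ _) ⟨
    0# * (⟦ b₁ ⟧ * ⟦ c ⟧) + 1# * (⟦ b₂ ⟧ * ⟦ c ⟧) ∎
  ⟦⟧-∧-∨ c false b₁ false b₂ _ = begin
    ⟦ c ∧ false ⟧                               ≡⟨ cong ⟦_⟧ (∧-zeroʳ c) ⟩
    0#                                          ≈⟨ ≈-trans (+-cong (zeroˡ _) (zeroˡ _)) (+-identityʳ _) ⟨
    0# * (⟦ b₁ ⟧ * ⟦ c ⟧) + 0# * (⟦ b₂ ⟧ * ⟦ c ⟧) ∎

  sumK²-select : ∀ n (p q : Fin n) (f : Fin n → Fin n → Carrier) →
    sumK² n (λ a b → ⟦ a ≟ᵇ p ⟧ * (⟦ b ≟ᵇ q ⟧ * f a b)) ≈ f p q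
  sumK²-select n p q f = begin
    sumK² n (λ a b → ⟦ a ≟ᵇ p ⟧ * (⟦ b ≟ᵇ q ⟧ * f a b))
      ≈⟨ sumK-cong n (λ a → ≈-sym (*-distribˡ-sumK n ⟦ a ≟ᵇ p ⟧ (λ b → ⟦ b ≟ᵇ q ⟧ * f a b))) ⟩
    sumK K n (λ a → ⟦ a ≟ᵇ p ⟧ * sumK K n (λ b → ⟦ b ≟ᵇ q ⟧ * f a b))
      ≈⟨ sumK-cong n (λ a → *-congˡ (sumK-select n q (f a))) ⟩
    sumK K n (λ a → ⟦ a ≟ᵇ p ⟧ * f a q)
      ≈⟨ sumK-select n p (λ a → f a q) ⟩
    f p q ∎

  ⟦<ᶠ⟧-+-⟦>ᶠ⟧ : ∀ {n} {p q : Fin n} → p ≢ q → ⟦ p <ᶠ q ⟧ + ⟦ q <ᶠ p ⟧ ≈ 1#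
  ⟦<ᶠ⟧-+-⟦>ᶠ⟧ p≢q with <ᶠ-orient p≢q
  ... | inj₁ (p<q , q≮p) rewrite p<q | q≮p = +-identityʳ 1#
  ... | inj₂ (p≮q , q<p) rewrite p≮q | q<p = +-identityˡ 1#

  sum-increasing-pair : ∀ n {p q : Fin n} → p ≢ q → sumK² n (λ a b → ⟦ a <ᶠ b ∧ sameEdge p q a b ⟧) ≈ 1#
  sum-increasing-pair n {p} {q} p≢q = begin
    sumK² n (λ a b → ⟦ a <ᶠ b ∧ sameEdge p q a b ⟧)
      ≈⟨ sumK²-cong n (λ a b → ⟦⟧-∧-∨ (a <ᶠ b) (a ≟ᵇ p) (b ≟ᵇ q) (a ≟ᵇ q) (b ≟ᵇ p) (not-both a)) ⟩
    sumK² n (λ a b → at p q a b + at q p a b)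
      ≈⟨ sumK²-distrib-+ n (at p q) (at q p) ⟩
    sumK² n (at p q) + sumK² n (at q p)
      ≈⟨ +-cong (sumK²-select n p q (λ a b → ⟦ a <ᶠ b ⟧)) (sumK²-select n q p (λ a b → ⟦ a <ᶠ b ⟧)) ⟩
    ⟦ p <ᶠ q ⟧ + ⟦ q <ᶠ p ⟧
      ≈⟨ ⟦<ᶠ⟧-+-⟦>ᶠ⟧ p≢q ⟩
    1# ∎
    where
      at : Fin n → Fin n → Fin n → Fin n → Carrier
      at p q a b = ⟦ a ≟ᵇ p ⟧ * (⟦ b ≟ᵇ q ⟧ * ⟦ a <ᶠ b ⟧)
      not-both : ∀ a → (a ≟ᵇ p) ∧ (a ≟ᵇ q) ≡ false
      not-both a with a ≟ᵇ p in a≟p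
      ... | false = refl
      ... | true rewrite ≟ᵇ⇒≡ {a = a} {b = p} a≟p = ≢⇒≟ᵇ-false p≢q

  -- The test vector on a path u v w

  module PathVector {n : ℕ} (G : Graph n) (P : Path₃ G) (h : ℕ) (γ : Carrier) (γ^e≈-1 : γ ^ (2 *ℕ suc h) ≈ - 1#) where
    open Path₃ P
    open EvenPower h using (e)

    β : Carrier
    β = - (1# + γ)

    x : Fin n → Carrier
    x z = ⟦ z ≟ᵇ u ⟧ + ⟦ z ≟ᵇ v ⟧ * β + ⟦ z ≟ᵇ w ⟧ * γ

    open Pairing x public

    u≢v : u ≢ v
    u≢v = adj⇒≢ G uv

    v≢w : v ≢ w
    v≢w = adj⇒≢ G vw

    x-u : x u ≈ 1#
    x-u rewrite ≟ᵇ-refl u | ≢⇒≟ᵇ-false u≢v | ≢⇒≟ᵇ-false u≢w =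
      ≈-trans (+-cong (+-congˡ (zeroˡ β)) (zeroˡ γ)) (≈-trans (+-identityʳ _) (+-identityʳ _))

    ⟨⟩-x : ∀ c → ⟨ c ⟩ ≈ c u + c v * β + c w * γ
    ⟨⟩-x c = begin
      sumK K n (λ z → c z * x z)
        ≈⟨ sumK-cong n (λ z → expand (c z) ⟦ z ≟ᵇ u ⟧ ⟦ z ≟ᵇ v ⟧ β ⟦ z ≟ᵇ w ⟧ γ) ⟩
      sumK K n (λ z → at u z + at v z * β + at w z * γ)
        ≈⟨ ≈-trans (sumK-distrib-+ n (λ z → at u z + at v z * β) (λ z → at w z * γ))
                   (+-congʳ (sumK-distrib-+ n (at u) (λ z → at v z * β))) ⟩
      sumK K n (at u) + sumK K n (λ z → at v z * β) + sumK K n (λ z → at w z * γ)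
        ≈⟨ +-cong (+-congˡ (*-distribʳ-sumK n β (at v))) (*-distribʳ-sumK n γ (at w)) ⟨
      sumK K n (at u) + sumK K n (at v) * β + sumK K n (at w) * γ
        ≈⟨ +-cong (+-cong (sumK-select n u c) (*-congʳ (sumK-select n v c))) (*-congʳ (sumK-select n w c)) ⟩
      c u + c v * β + c w * γ ∎
      where
        at : Fin n → Fin n → Carrier
        at p z = ⟦ z ≟ᵇ p ⟧ * c z
        expand : ∀ c a b β d γ → c * (a + b * β + d * γ) ≈ a * c + b * c * β + d * c * γ
        expand = solve 6 (λ c a b β d γ → c :* (a :+ b :* β :+ d :* γ) := a :* c :+ b :* c :* β :+ d :* c :* γ) ≈-refl

    1+β≈-γ : 1# + β ≈ - γ
    1+β≈-γ = begin
      1# + - (1# + γ)    ≈⟨ +-congˡ (-‿+-comm 1# γ) ⟨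
      1# + (- 1# + - γ)  ≈⟨ +-assoc _ _ _ ⟨
      1# + - 1# + - γ    ≈⟨ +-congʳ (-‿inverseʳ 1#) ⟩
      0# + - γ           ≈⟨ +-identityˡ _ ⟩
      - γ                ∎

    1+β+γ≈0 : 1# + β + γ ≈ 0#
    1+β+γ≈0 = ≈-trans (+-congʳ 1+β≈-γ) (-‿inverseˡ γ)

    β+γ≈-1 : β + γ ≈ - 1#
    β+γ≈-1 = +-inverseʳ-unique 1# (β + γ) (≈-trans (≈-sym (+-assoc _ _ _)) 1+β+γ≈0)

    ⟨⟩-1 : ⟨ (λ _ → 1#) ⟩ ≈ 0#
    ⟨⟩-1 = ≈-trans (⟨⟩-x _) (≈-trans (+-cong (+-congˡ (*-identityˡ β)) (*-identityˡ γ)) 1+β+γ≈0)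

    value : Bool → Bool → Bool → Carrier
    value p q r = ⟦ p ⟧ + ⟦ q ⟧ * β + ⟦ r ⟧ * γ

    value-first : ∀ {p q r} → p ≡ not q → r ≡ q → value p q r ^ e ≈ 1#
    value-first {q = true} refl refl = begin
      (0# + 1# * β + 1# * γ) ^ e
        ≈⟨ ^-congˡ e (≈-trans (+-cong (≈-trans (+-identityˡ _) (*-identityˡ β)) (*-identityˡ γ)) β+γ≈-1) ⟩
      (- 1#) ^ e
        ≈⟨ -^-even 1# (suc h) ⟩
      1# ^ e
        ≈⟨ 1#^ e ⟩
      1# ∎
    value-first {q = false} refl refl = begin
      (1# + 0# * β + 0# * γ) ^ e
        ≈⟨ ^-congˡ e (≈-trans (+-cong (≈-trans (+-congˡ (zeroˡ β)) (+-identityʳ _)) (zeroˡ γ)) (+-identityʳ _)) ⟩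
      1# ^ e
        ≈⟨ 1#^ e ⟩
      1# ∎

    value-last : ∀ {p q r} → p ≡ q → r ≡ not q → value p q r ^ e ≈ - 1#
    value-last {q = true} refl refl = begin
      (1# + 1# * β + 0# * γ) ^ e
        ≈⟨ ^-congˡ e (≈-trans (+-cong (+-congˡ (*-identityˡ β)) (zeroˡ γ)) (≈-trans (+-identityʳ _) 1+β≈-γ)) ⟩
      (- γ) ^ e
        ≈⟨ -^-even γ (suc h) ⟩
      γ ^ e
        ≈⟨ γ^e≈-1 ⟩
      - 1# ∎
    value-last {q = false} refl refl = begin
      (0# + 0# * β + 1# * γ) ^ e
        ≈⟨ ^-congˡ e (≈-trans (+-cong (≈-trans (+-identityˡ _) (zeroˡ β)) (*-identityˡ γ)) (+-identityˡ γ)) ⟩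
      γ ^ e
        ≈⟨ γ^e≈-1 ⟩
      - 1# ∎

    value-same : ∀ {p q r} → p ≡ q → r ≡ q → value p q r ^ e ≈ 0#
    value-same {q = true} refl refl =
      ≈-trans (^-congˡ e (≈-trans (+-cong (+-congˡ (*-identityˡ β)) (*-identityˡ γ)) 1+β+γ≈0)) (zeroˡ _)
    value-same {q = false} refl refl =
      ≈-trans (^-congˡ e (≈-trans (+-cong (≈-trans (+-identityˡ _) (zeroˡ β)) (zeroˡ γ)) (+-identityˡ 0#))) (zeroˡ _)

    two-edges : ∀ {a b} → SameEdge u v a b → SameEdge v w a b → ⊥
    two-edges (inj₁ (refl , refl)) (inj₁ (u≡v , _))   = u≢v u≡v
    two-edges (inj₁ (refl , refl)) (inj₂ (u≡w , _))   = u≢w u≡w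
    two-edges (inj₂ (refl , refl)) (inj₁ (_ , u≡w))   = u≢w u≡w
    two-edges (inj₂ (refl , refl)) (inj₂ (v≡w , _))   = v≢w v≡w

    power-at : ∀ (σ : Fin n → Bool) → ⟨ ⟦_⟧ ∘ σ ⟩ ^ e ≈ value (σ u) (σ v) (σ w) ^ e
    power-at σ = ^-congˡ e (⟨⟩-x (⟦_⟧ ∘ σ))

    module _ (acyclic : Acyclic G) {a b : Fin n} where

      first-edge : SameEdge u v a b → ¬ SameEdge a b v w → ⟨ ⟦_⟧ ∘ side G a b ⟩ ^ e ≈ 1#
      first-edge uv-ab vw≠ab = ≈-trans (power-at (side G a b))
        (value-first (cut-separates cut (SameEdge-sym uv-ab)) (sym (cut-sameSide cut vw vw≠ab)))
        where
          cut : IsCut G (side G a b) a b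
          cut = side-cut acyclic (adj-SameEdge G uv-ab uv)

      last-edge : SameEdge v w a b → ¬ SameEdge a b u v → ⟨ ⟦_⟧ ∘ side G a b ⟩ ^ e ≈ - 1#
      last-edge vw-ab uv≠ab = ≈-trans (power-at (side G a b))
        (value-last (cut-sameSide cut uv uv≠ab) (cut-separates cut (SameEdge-flip (SameEdge-sym vw-ab))))
        where
          cut : IsCut G (side G a b) a b
          cut = side-cut acyclic (adj-SameEdge G vw-ab vw)

      other-edge : adj G a b ≡ true → ¬ SameEdge a b u v → ¬ SameEdge a b v w → ⟨ ⟦_⟧ ∘ side G a b ⟩ ^ e ≈ 0#
      other-edge ab uv≠ab vw≠ab = ≈-trans (power-at (side G a b))
        (value-same (cut-sameSide cut uv uv≠ab) (sym (cut-sameSide cut vw vw≠ab)))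
        where
          cut : IsCut G (side G a b) a b
          cut = side-cut acyclic ab

    edge-contribution : Acyclic G → ∀ a b →
      ⟦ a <ᶠ b ∧ adj G a b ⟧ * ⟨ ⟦_⟧ ∘ side G a b ⟩ ^ e
        ≈ ⟦ a <ᶠ b ∧ sameEdge u v a b ⟧ + ⟦ a <ᶠ b ∧ sameEdge v w a b ⟧ * - 1#
    edge-contribution acyclic a b with a <ᶠ b
    ... | false = ≈-trans (zeroˡ _) (≈-sym (≈-trans (+-identityˡ _) (zeroˡ _)))
    ... | true with sameEdge u v a b in on-uv | sameEdge v w a b in on-vw
    ...   | true | true = ⊥-elim (two-edges (sameEdge⇒SameEdge u v a b on-uv) (sameEdge⇒SameEdge v w a b on-vw))
    ...   | true | false = begin
      ⟦ adj G a b ⟧ * ⟨ ⟦_⟧ ∘ side G a b ⟩ ^ e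
        ≈⟨ ⟦⟧-true _ (adj-SameEdge G (sameEdge⇒SameEdge u v a b on-uv) uv) ⟩
      ⟨ ⟦_⟧ ∘ side G a b ⟩ ^ e
        ≈⟨ first-edge acyclic (sameEdge⇒SameEdge u v a b on-uv) (sameEdge-false⇒¬SameEdge a b v w on-vw) ⟩
      1#
        ≈⟨ ≈-trans (+-congˡ (zeroˡ _)) (+-identityʳ 1#) ⟨
      1# + 0# * - 1# ∎
    ...   | false | true = begin
      ⟦ adj G a b ⟧ * ⟨ ⟦_⟧ ∘ side G a b ⟩ ^ e
        ≈⟨ ⟦⟧-true _ (adj-SameEdge G (sameEdge⇒SameEdge v w a b on-vw) vw) ⟩
      ⟨ ⟦_⟧ ∘ side G a b ⟩ ^ e
        ≈⟨ last-edge acyclic (sameEdge⇒SameEdge v w a b on-vw) (sameEdge-false⇒¬SameEdge a b u v on-uv) ⟩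
      - 1#
        ≈⟨ ≈-trans (+-identityˡ _) (*-identityˡ _) ⟨
      0# + 1# * - 1# ∎
    ...   | false | false with adj G a b in ab
    ...     | false = ≈-trans (zeroˡ _) (≈-sym (≈-trans (+-identityˡ _) (zeroˡ _)))
    ...     | true  = ≈-trans (*-identityˡ _) (≈-trans
                        (other-edge acyclic ab (sameEdge-false⇒¬SameEdge a b u v on-uv)
                                               (sameEdge-false⇒¬SameEdge a b v w on-vw))
                        (≈-sym (≈-trans (+-identityˡ _) (zeroˡ _))))

    sum-edge-contributions : Acyclic G → sumK² n (λ a b → ⟦ a <ᶠ b ∧ adj G a b ⟧ * ⟨ ⟦_⟧ ∘ side G a b ⟩ ^ e) ≈ 0#
    sum-edge-contributions acyclic = begin
      sumK² n (λ a b → ⟦ a <ᶠ b ∧ adj G a b ⟧ * ⟨ ⟦_⟧ ∘ side G a b ⟩ ^ e)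
        ≈⟨ sumK²-cong n (edge-contribution acyclic) ⟩
      sumK² n (λ a b → onUV a b + onVW a b * - 1#)
        ≈⟨ ≈-trans (sumK²-distrib-+ n onUV (λ a b → onVW a b * - 1#))
                   (+-congˡ (≈-sym (*-distribʳ-sumK² n (- 1#) onVW))) ⟩
      sumK² n onUV + sumK² n onVW * - 1#
        ≈⟨ +-cong (sum-increasing-pair n u≢v) (*-congʳ (sum-increasing-pair n v≢w)) ⟩
      1# + 1# * - 1#
        ≈⟨ ≈-trans (+-congˡ (*-identityˡ _)) (-‿inverseʳ 1#) ⟩
      0# ∎
      where
        onUV onVW : Fin n → Fin n → Carrier
        onUV a b = ⟦ a <ᶠ b ∧ sameEdge u v a b ⟧
        onVW a b = ⟦ a <ᶠ b ∧ sameEdge v w a b ⟧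

mainTheorem2 : ∀ {c ℓ : Level} (K : CommutativeRing c ℓ) → IsAlgClosedChar0Field K →
    (k : ℕ) → 3 ≤ k → Odd k →
    (n : ℕ) → 3 ≤ n → (T : Graph n) → IsTree T →
    (S : (Fin k → Fin n) → ℕ) → IsSteinerHypermatrix T S →
    HyperdetVanishes K k n S
mainTheorem2 K closed _ (s≤s (s≤s _)) (zero , ()) n _ T _ S _
mainTheorem2 K closed .(suc (2 *ℕ suc h)) _ (suc h , refl) .(3 +ℕ n) (s≤s (s≤s (s≤s {n = n} z≤n)))
             T (connected , acyclic) S isS =
  x , (u , λ x-u≈0 → nontrivial (≈-trans (≈-sym x-u) x-u≈0)) , ∇f≈0
  where
    open CommutativeRing K renaming (refl to ≈-refl; sym to ≈-sym; trans to ≈-trans)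
    open RingProperties ring using (-0#≈0#)
    open ExpProperties commutativeSemiring using (_^_)
    open RingCalculus K
    open EvenPower h using (e)
    open IsAlgClosedChar0Field closed using (nontrivial)
    open SetoidReasoning setoid
    root : ∃ λ γ → γ ^ e ≈ - 1#
    root = ∃-root-of-minus-one closed e
    open PathVector T (connected⇒Path₃ T connected) h (proj₁ root) (proj₂ root)
    open Path₃ (connected⇒Path₃ T connected) using (u)
    ∇f≈0 : ∀ m → partialF K (suc e) (3 +ℕ n) S x m ≈ 0#
    ∇f≈0 m = begin
      partialF K (suc e) (3 +ℕ n) S x m
        ≈⟨ Gradient.partialF-cutCount x m h (isEdge T) (side T) S (steinerDistance≡cutCount acyclic isS) ⟨⟩-1 ⟩
      - (ℕ→K K (suc e) * sumK² (3 +ℕ n) (λ a b → ⟦ isEdge T a b ⟧ * ⟨ ⟦_⟧ ∘ side T a b ⟩ ^ e))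
        ≈⟨ -‿cong (≈-trans (*-congˡ (sum-edge-contributions acyclic)) (zeroʳ _)) ⟩
      - 0#
        ≈⟨ -0#≈0# ⟩
      0# ∎
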